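{- The rule $(\supset_{r2})$ is invertible in $\mathsf{LNIF}$: if $\mathcal{G}/\!/\Gamma_1\vdash\Delta_1,A\supset B/\!/\Gamma_2\vdash\Delta_2/\!/\mathcal{H}$ is derivable in $\mathsf{LNIF}$, then both $\mathcal{G}/\!/\Gamma_1\vdash\Delta_1/\!/A\vdash B/\!/\Gamma_2\vdash\Delta_2/\!/\mathcal{H}$ and $\mathcal{G}/\!/\Gamma_1\vdash\Delta_1/\!/\Gamma_2\vdash\Delta_2,A\supset B/\!/\mathcal{H}$ are derivable in $\mathsf{LNIF}$.
   Context: Formulae are first-order over $\bot,\land,\lor,\supset,\forall,\exists$; in sequents bound variables $x,y,\dots$ are distinct from parameters $a,b,\dots$, which occupy all free positions; $A[a/x]$ replaces free occurrences of $x$ by $a$; $p(\vec a)$ is an atomic formula with parameters $\vec a$. A linear nested sequent is $\Gamma_1\vdash\Delta_1 /\!/ \cdots /\!/ \Gamma_n\vdash\Delta_n$ ($n\ge1$), each $\Gamma_i,\Delta_i$ a finite, possibly empty, multiset of formulae (a component). In rule schemas, $\mathcal{G},\mathcal{H},\mathcal{F}$ denote possibly empty sequences of components. $\mathsf{LNIF}$ has the rules (from premise(s) infer conclusion): Initial: $(id_1)$ $\mathcal{G}/\!/\Gamma,p(\vec a)\vdash p(\vec a),\Delta/\!/\mathcal{H}$; $(id_2)$ $\mathcal{G}/\!/\Gamma_1,p(\vec a)\vdash\Delta_1/\!/\mathcal{H}/\!/\Gamma_2\vdash p(\vec a),\Delta_2/\!/\mathcal{F}$; $(\bot_l)$ $\mathcal{G}/\!/\Gamma,\bot\vdash\Delta/\!/\mathcal{H}$.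 $(\land_l)$: from $\mathcal{G}/\!/\Gamma,A,B\vdash\Delta/\!/\mathcal{H}$ infer $\mathcal{G}/\!/\Gamma,A\land B\vdash\Delta/\!/\mathcal{H}$. $(\lor_r)$: from $\mathcal{G}/\!/\Gamma\vdash\Delta,A,B/\!/\mathcal{H}$ infer $\mathcal{G}/\!/\Gamma\vdash\Delta,A\lor B/\!/\mathcal{H}$. $(\land_r)$: from $\mathcal{G}/\!/\Gamma\vdash\Delta,A/\!/\mathcal{H}$ and $\mathcal{G}/\!/\Gamma\vdash\Delta,B/\!/\mathcal{H}$ infer $\mathcal{G}/\!/\Gamma\vdash\Delta,A\land B/\!/\mathcal{H}$. $(\lor_l)$: from $\mathcal{G}/\!/\Gamma,A\vdash\Delta/\!/\mathcal{H}$ and $\mathcal{G}/\!/\Gamma,B\vdash\Delta/\!/\mathcal{H}$ infer $\mathcal{G}/\!/\Gamma,A\lor B\vdash\Delta/\!/\mathcal{H}$. $(\supset_{r1})$: from $\mathcal{G}/\!/\Gamma\vdash\Delta/\!/A\vdash B$ infer $\mathcal{G}/\!/\Gamma\vdash\Delta,A\supset B$. $(\supset_l)$: from $\mathcal{G}/\!/\Gamma,B\vdash\Delta/\!/\mathcal{H}$ and $\mathcal{G}/\!/\Gamma,A\supset B\vdash A,\Delta/\!/\mathcal{H}$ infer $\mathcal{G}/\!/\Gamma,A\supset B\vdash\Delta/\!/\mathcal{H}$. $(lift)$: from $\mathcal{G}/\!/\Gamma_1,A\vdash\Delta_1/\!/\Gamma_2,A\vdash\Delta_2/\!/\mathcal{H}$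 infer $\mathcal{G}/\!/\Gamma_1,A\vdash\Delta_1/\!/\Gamma_2\vdash\Delta_2/\!/\mathcal{H}$. $(\forall_l)$: from $\mathcal{G}/\!/\Gamma,A[a/x],\forall xA\vdash\Delta/\!/\mathcal{H}$ infer $\mathcal{G}/\!/\Gamma,\forall xA\vdash\Delta/\!/\mathcal{H}$ ($a$ any parameter). $(\forall_{r1})$: from $\mathcal{G}/\!/\Gamma\vdash\Delta/\!/\ \vdash A[a/x]$ infer $\mathcal{G}/\!/\Gamma\vdash\Delta,\forall xA$. $(\exists_l)$: from $\mathcal{G}/\!/\Gamma,A[a/x]\vdash\Delta/\!/\mathcal{H}$ infer $\mathcal{G}/\!/\Gamma,\exists xA\vdash\Delta/\!/\mathcal{H}$. $(\exists_r)$: from $\mathcal{G}/\!/\Gamma\vdash A[a/x],\exists xA,\Delta/\!/\mathcal{H}$ infer $\mathcal{G}/\!/\Gamma\vdash\exists xA,\Delta/\!/\mathcal{H}$ ($a$ any parameter). $(\supset_{r2})$: from $\mathcal{G}/\!/\Gamma_1\vdash\Delta_1/\!/A\vdash B/\!/\Gamma_2\vdash\Delta_2/\!/\mathcal{H}$ and $\mathcal{G}/\!/\Gamma_1\vdash\Delta_1/\!/\Gamma_2\vdash\Delta_2,A\supset B/\!/\mathcal{H}$ infer $\mathcal{G}/\!/\Gamma_1\vdash\Delta_1,A\supset B/\!/\Gamma_2\vdash\Delta_2/\!/\mathcal{H}$. $(\forall_{r2})$: from $\mathcal{G}/\!/\Gamma_1\vdash\Delta_1/\!/\ \vdash A[a/x]/\!/\Gamma_2\vdash\Delta_2/\!/\mathcal{H}$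 and $\mathcal{G}/\!/\Gamma_1\vdash\Delta_1/\!/\Gamma_2\vdash\Delta_2,\forall xA/\!/\mathcal{H}$ infer $\mathcal{G}/\!/\Gamma_1\vdash\Delta_1,\forall xA/\!/\Gamma_2\vdash\Delta_2/\!/\mathcal{H}$. In $(\forall_{r1}),(\exists_l),(\forall_{r2})$, $a$ is an eigenvariable (does not occur in the conclusion). -}

module Defs where

open import Data.Nat using (ℕ; _≟_)
open import Data.List using (List; []; _∷_; _++_; [_])
open import Data.List.Relation.Binary.Permutation.Propositional using (_↭_)
open import Data.List.Relation.Unary.Any using (Any)
open import Data.Product using (_×_; _,_)
open import Data.Sum using (_⊎_)
open import Relation.Nullary using (¬_; yes; no)
open import Relation.Binary.PropositionalEquality using (_≡_)

-- Bound variables and parameters are two disjoint sorts, both indexed by ℕ.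
Var : Set
Var = ℕ

Par : Set
Par = ℕ

data Term : Set where
  var : Var → Term
  par : Par → Term

data Formula : Set where
  atom : ℕ → List Term → Formula
  ⊥'   : Formula
  _∧'_ : Formula → Formula → Formula
  _∨'_ : Formula → Formula → Formula
  _⊃_  : Formula → Formula → Formula
  ∀'   : Var → Formula → Formula
  ∃'   : Var → Formula → Formula

substT : Term → Var → Par → Term
substT (var y) x a with y ≟ x
... | yes _ = par a
... | no _  = var y
substT (par b) x a = par b

substTs : List Term → Var → Par → List Term
substTs []       x a = []
substTs (t ∷ ts) x a = substT t x a ∷ substTs ts x a

_[_/_] : Formula → Par → Var → Formula
atom p ts [ a / x ] = atom p (substTs ts x a)
⊥'        [ a / x ] = ⊥'
(A ∧' B)  [ a / x ] = (A [ a / x ]) ∧' (B [ a / x ])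
(A ∨' B)  [ a / x ] = (A [ a / x ]) ∨' (B [ a / x ])
(A ⊃ B)   [ a / x ] = (A [ a / x ]) ⊃ (B [ a / x ])
∀' y A    [ a / x ] with y ≟ x
... | yes _ = ∀' y A
... | no _  = ∀' y (A [ a / x ])
∃' y A    [ a / x ] with y ≟ x
... | yes _ = ∃' y A
... | no _  = ∃' y (A [ a / x ])

data OccT (a : Par) : Term → Set where
  here : OccT a (par a)

data Occ (a : Par) : Formula → Set where
  atm  : ∀ {p ts} → Any (OccT a) ts → Occ a (atom p ts)
  ∧ˡ   : ∀ {A B} → Occ a A → Occ a (A ∧' B)
  ∧ʳ   : ∀ {A B} → Occ a B → Occ a (A ∧' B)
  ∨ˡ   : ∀ {A B} → Occ a A → Occ a (A ∨' B)
  ∨ʳ   : ∀ {A B} → Occ a B → Occ a (A ∨' B)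
  ⊃ˡ   : ∀ {A B} → Occ a A → Occ a (A ⊃ B)
  ⊃ʳ   : ∀ {A B} → Occ a B → Occ a (A ⊃ B)
  ∀o   : ∀ {x A} → Occ a A → Occ a (∀' x A)
  ∃o   : ∀ {x A} → Occ a A → Occ a (∃' x A)

-- Multisets are lists considered up to permutation (_↭_).
Multiset : Set
Multiset = List Formula

infix 4.7 _⊢_
record Component : Set where
  constructor _⊢_
  field
    ant : Multiset
    suc : Multiset

-- A linear nested sequent is a list of components (nonemptiness holds for all
-- sequents appearing in the rules below, by construction).
LNS : Set
LNS = List Component

OccC : Par → Component → Set
OccC a (Γ ⊢ Δ) = Any (Occ a) Γ ⊎ Any (Occ a) Δ

OccS : Par → LNS → Set
OccS a G = Any (OccC a) G

infixr 4.5 _//_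
_//_ : Component → LNS → LNS
c // H = c ∷ H

-- Derivability in LNIF. Multiset side conditions are expressed via _↭_:
-- the conclusion's component is any list that is a permutation of the
-- displayed one.
data LNIF : LNS → Set where
  id₁ : ∀ G H Γ Δ Γ' Δ' p ts →
        Γ' ↭ atom p ts ∷ Γ → Δ' ↭ atom p ts ∷ Δ →
        LNIF (G ++ ((Γ' ⊢ Δ') // H))
  id₂ : ∀ G H F Γ₁ Δ₁ Γ₂ Δ₂ Γ₁' Δ₂' p ts →
        Γ₁' ↭ atom p ts ∷ Γ₁ → Δ₂' ↭ atom p ts ∷ Δ₂ →
        LNIF (G ++ ((Γ₁' ⊢ Δ₁) // (H ++ ((Γ₂ ⊢ Δ₂') // F))))
  ⊥l  : ∀ G H Γ Δ Γ' →
        Γ' ↭ ⊥' ∷ Γ →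
        LNIF (G ++ ((Γ' ⊢ Δ) // H))
  ∧l  : ∀ G H Γ Δ Γ' A B →
        Γ' ↭ (A ∧' B) ∷ Γ →
        LNIF (G ++ ((A ∷ B ∷ Γ ⊢ Δ) // H)) →
        LNIF (G ++ ((Γ' ⊢ Δ) // H))
  ∨r  : ∀ G H Γ Δ Δ' A B →
        Δ' ↭ (A ∨' B) ∷ Δ →
        LNIF (G ++ ((Γ ⊢ A ∷ B ∷ Δ) // H)) →
        LNIF (G ++ ((Γ ⊢ Δ') // H))
  ∧r  : ∀ G H Γ Δ Δ' A B →
        Δ' ↭ (A ∧' B) ∷ Δ →
        LNIF (G ++ ((Γ ⊢ A ∷ Δ) // H)) →
        LNIF (G ++ ((Γ ⊢ B ∷ Δ) // H)) →
        LNIF (G ++ ((Γ ⊢ Δ') // H))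
  ∨l  : ∀ G H Γ Δ Γ' A B →
        Γ' ↭ (A ∨' B) ∷ Γ →
        LNIF (G ++ ((A ∷ Γ ⊢ Δ) // H)) →
        LNIF (G ++ ((B ∷ Γ ⊢ Δ) // H)) →
        LNIF (G ++ ((Γ' ⊢ Δ) // H))
  ⊃r₁ : ∀ G Γ Δ Δ' A B →
        Δ' ↭ (A ⊃ B) ∷ Δ →
        LNIF (G ++ ((Γ ⊢ Δ) // [ ([ A ] ⊢ [ B ]) ])) →
        LNIF (G ++ ([ Γ ⊢ Δ' ]))
  ⊃l  : ∀ G H Γ Δ Γ' A B →
        Γ' ↭ (A ⊃ B) ∷ Γ →
        LNIF (G ++ ((B ∷ Γ ⊢ Δ) // H)) →
        LNIF (G ++ ((Γ' ⊢ A ∷ Δ) // H)) →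
        LNIF (G ++ ((Γ' ⊢ Δ) // H))
  lift : ∀ G H Γ₁ Δ₁ Γ₂ Δ₂ Γ₁' A →
        Γ₁' ↭ A ∷ Γ₁ →
        LNIF (G ++ ((Γ₁' ⊢ Δ₁) // (A ∷ Γ₂ ⊢ Δ₂) // H)) →
        LNIF (G ++ ((Γ₁' ⊢ Δ₁) // (Γ₂ ⊢ Δ₂) // H))
  ∀l  : ∀ G H Γ Δ Γ' x A (a : Par) →
        Γ' ↭ ∀' x A ∷ Γ →
        LNIF (G ++ (((A [ a / x ]) ∷ Γ' ⊢ Δ) // H)) →
        LNIF (G ++ ((Γ' ⊢ Δ) // H))
  ∀r₁ : ∀ G Γ Δ Δ' x A (a : Par) →
        Δ' ↭ ∀' x A ∷ Δ →
        ¬ OccS a (G ++ [ Γ ⊢ Δ' ]) →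
        LNIF (G ++ ((Γ ⊢ Δ) // [ ([] ⊢ [ A [ a / x ] ]) ])) →
        LNIF (G ++ ([ Γ ⊢ Δ' ]))
  ∃l  : ∀ G H Γ Δ Γ' x A (a : Par) →
        Γ' ↭ ∃' x A ∷ Γ →
        ¬ OccS a (G ++ ((Γ' ⊢ Δ) // H)) →
        LNIF (G ++ (((A [ a / x ]) ∷ Γ ⊢ Δ) // H)) →
        LNIF (G ++ ((Γ' ⊢ Δ) // H))
  ∃r  : ∀ G H Γ Δ Δ' x A (a : Par) →
        Δ' ↭ ∃' x A ∷ Δ →
        LNIF (G ++ ((Γ ⊢ (A [ a / x ]) ∷ Δ') // H)) →
        LNIF (G ++ ((Γ ⊢ Δ') // H))
  ⊃r₂ : ∀ G H Γ₁ Δ₁ Γ₂ Δ₂ Δ₁' A B →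
        Δ₁' ↭ (A ⊃ B) ∷ Δ₁ →
        LNIF (G ++ ((Γ₁ ⊢ Δ₁) // ([ A ] ⊢ [ B ]) // (Γ₂ ⊢ Δ₂) // H)) →
        LNIF (G ++ ((Γ₁ ⊢ Δ₁) // (Γ₂ ⊢ (A ⊃ B) ∷ Δ₂) // H)) →
        LNIF (G ++ ((Γ₁ ⊢ Δ₁') // (Γ₂ ⊢ Δ₂) // H))
  ∀r₂ : ∀ G H Γ₁ Δ₁ Γ₂ Δ₂ Δ₁' x A (a : Par) →
        Δ₁' ↭ ∀' x A ∷ Δ₁ →
        ¬ OccS a (G ++ ((Γ₁ ⊢ Δ₁') // (Γ₂ ⊢ Δ₂) // H)) →
        LNIF (G ++ ((Γ₁ ⊢ Δ₁) // ([] ⊢ [ A [ a / x ] ]) // (Γ₂ ⊢ Δ₂) // H)) →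
        LNIF (G ++ ((Γ₁ ⊢ Δ₁) // (Γ₂ ⊢ ∀' x A ∷ Δ₂) // H)) →
        LNIF (G ++ ((Γ₁ ⊢ Δ₁') // (Γ₂ ⊢ Δ₂) // H))

module Submission where

-- Both claims are proved by induction on derivation height, in a
-- height-indexed copy of LNIF.  The second one is the height-preserving
-- admissibility of moving a succedent formula of a component into the
-- succedent of the next component: every rule instance commutes with such a
-- move, and moving the principal A ⊃ B of (⊃r₂) just returns that rule's right
-- premise.  The first one is the admissibility of replacing a succedent A ⊃ B
-- by a new component Π, A ⊢ B right after its component, where Π collects the
-- formulae that (lift) pushes into the new component.  A rule (⊃r₁), (∀r₁),
-- (⊃r₂) or (∀r₂) on that component with another principal formula is
-- re-derived by (⊃r₂)/(∀r₂) in front of the new component, whose left premise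
-- needs the move of A ⊃ B first.  Eigenvariables are handled by renaming them
-- to fresh parameters, which together with weakening preserves height.

open import Defs
open import Data.List using (List; []; _∷_; _++_; [_]; map)
open import Data.List.Properties using (++-assoc)
open import Data.List.Membership.Propositional using (_∈_)
import Data.List.Membership.Propositional.Properties as ∈
open import Data.List.Relation.Unary.Any using (Any; here; there)
import Data.List.Relation.Unary.Any.Properties as Any
open import Data.List.Relation.Binary.Permutation.Propositional
  using (_↭_; ↭-refl; ↭-sym; ↭-trans; ↭-prep; ↭-swap)
import Data.List.Relation.Binary.Permutation.Propositional.Properties as ↭
open import Data.List.Relation.Binary.Pointwise as Pw using (Pointwise; []; _∷_)
open import Data.Nat using (ℕ; suc; _⊔_; _≤_; _≟_; s≤s)
open import Data.Nat.Properties using (≤-trans; m≤m⊔n; m≤n⊔m; n≤1+n; <-irrefl)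
open import Data.Product using (_×_; _,_; Σ; ∃; ∃₂; proj₁; proj₂)
open import Data.Sum using (inj₁; inj₂)
open import Data.Empty using (⊥-elim)
open import Function using (_∘_)
open import Relation.Nullary using (¬_; yes; no)
open import Relation.Binary.PropositionalEquality
  using (_≡_; refl; sym; trans; cong; cong₂; subst)

open Component renaming (suc to succ)

module _ {A : Set} where

  ∈⇒↭ : ∀ {x : A} {xs} → x ∈ xs → ∃ λ ys → xs ↭ x ∷ ys
  ∈⇒↭ {x} x∈xs with ∈.∈-∃++ x∈xs
  ... | ys , zs , refl = ys ++ zs , ↭.shift x ys zs

  ↭∷⇒∈ : ∀ {x : A} {xs ys} → xs ↭ x ∷ ys → x ∈ xs
  ↭∷⇒∈ p = ↭.∈-resp-↭ (↭-sym p) (here refl)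

  ↭∷-∈ : ∀ {x y : A} {xs ys} → y ∈ ys → xs ↭ x ∷ ys → y ∈ xs
  ↭∷-∈ y∈ys p = ↭.∈-resp-↭ (↭-sym p) (there y∈ys)

  ↭-∷-≡ : ∀ {x y : A} {xs ys} → x ≡ y → xs ↭ ys → x ∷ xs ↭ y ∷ ys
  ↭-∷-≡ refl p = ↭-prep _ p

  ↭-prep-under : ∀ {x y : A} {xs ys} → xs ↭ x ∷ ys → y ∷ xs ↭ x ∷ y ∷ ys
  ↭-prep-under {x} {y} p = ↭-trans (↭-prep y p) (↭-swap y x ↭-refl)

  ↭-prep₂-under : ∀ {x y z : A} {xs ys} → xs ↭ x ∷ ys → y ∷ z ∷ xs ↭ x ∷ y ∷ z ∷ ys
  ↭-prep₂-under {x} {y} {z} {ys = ys} p =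
    ↭-trans (↭-prep y (↭-prep z p)) (↭.shift x (y ∷ z ∷ []) ys)

  ↭-select₂ : ∀ {x y : A} {xs ys zs} → xs ↭ x ∷ ys → ys ↭ y ∷ zs → xs ↭ y ∷ x ∷ zs
  ↭-select₂ {x} {y} p q = ↭-trans p (↭-trans (↭-prep x q) (↭-swap x y ↭-refl))

  data Remove₂ (x : A) (xs : List A) (y : A) (ys : List A) : Set where
    same     : x ≡ y → xs ↭ ys → Remove₂ x xs y ys
    distinct : ∀ zs → xs ↭ y ∷ zs → ys ↭ x ∷ zs → Remove₂ x xs y ys

  remove₂ : ∀ {x y : A} {zs xs ys} → zs ↭ x ∷ xs → zs ↭ y ∷ ys → Remove₂ x xs y ys
  remove₂ p q = split (↭-trans (↭-sym p) q)
    where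
    split : ∀ {x y xs ys} → x ∷ xs ↭ y ∷ ys → Remove₂ x xs y ys
    split {x} {y} r with ↭.∈-resp-↭ r (here refl)
    ... | here refl = same refl (↭.drop-∷ r)
    ... | there x∈ys with ∈.∈-∃++ x∈ys
    ...   | us , vs , refl = distinct (us ++ vs) (↭.drop-mid [] (y ∷ us) r) (↭.shift x us vs)

  Any-split : ∀ {P : A → Set} {xs} → Any P xs →
              ∃₂ λ ys zs → Σ A λ x → xs ≡ ys ++ x ∷ zs × P x
  Any-split (here {x} {zs} px) = [] , zs , x , refl , px
  Any-split (there {y} pxs) with Any-split pxs
  ... | ys , zs , x , refl , px = y ∷ ys , zs , x , refl , px

  Any-mid : ∀ {P : A → Set} ys {x zs} → P x → Any P (ys ++ x ∷ zs)
  Any-mid ys px = Any.++⁺ʳ ys (here px)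

renTerm : (Par → Par) → Term → Term
renTerm ρ (var y) = var y
renTerm ρ (par b) = par (ρ b)

renTerms : (Par → Par) → List Term → List Term
renTerms ρ = map (renTerm ρ)

ren : (Par → Par) → Formula → Formula
ren ρ (atom p ts) = atom p (renTerms ρ ts)
ren ρ ⊥'          = ⊥'
ren ρ (A ∧' B)    = ren ρ A ∧' ren ρ B
ren ρ (A ∨' B)    = ren ρ A ∨' ren ρ B
ren ρ (A ⊃ B)     = ren ρ A ⊃ ren ρ B
ren ρ (∀' y A)    = ∀' y (ren ρ A)
ren ρ (∃' y A)    = ∃' y (ren ρ A)

renList : (Par → Par) → Multiset → Multiset
renList ρ = map (ren ρ)

renComp : (Par → Par) → Component → Component
renComp ρ (Γ ⊢ Δ) = renList ρ Γ ⊢ renList ρ Δ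

renTerms-substTs : ∀ ρ ts x a → renTerms ρ (substTs ts x a) ≡ substTs (renTerms ρ ts) x (ρ a)
renTerms-substTs ρ []           x a = refl
renTerms-substTs ρ (par b ∷ ts) x a = cong (par (ρ b) ∷_) (renTerms-substTs ρ ts x a)
renTerms-substTs ρ (var y ∷ ts) x a with y ≟ x
... | yes _ = cong (par (ρ a) ∷_) (renTerms-substTs ρ ts x a)
... | no _  = cong (var y ∷_) (renTerms-substTs ρ ts x a)

ren-[/] : ∀ ρ A x a → ren ρ (A [ a / x ]) ≡ ren ρ A [ ρ a / x ]
ren-[/] ρ (atom p ts) x a = cong (atom p) (renTerms-substTs ρ ts x a)
ren-[/] ρ ⊥'          x a = refl
ren-[/] ρ (A ∧' B)    x a = cong₂ _∧'_ (ren-[/] ρ A x a) (ren-[/] ρ B x a)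
ren-[/] ρ (A ∨' B)    x a = cong₂ _∨'_ (ren-[/] ρ A x a) (ren-[/] ρ B x a)
ren-[/] ρ (A ⊃ B)     x a = cong₂ _⊃_ (ren-[/] ρ A x a) (ren-[/] ρ B x a)
ren-[/] ρ (∀' y A)    x a with y ≟ x
... | yes _ = refl
... | no _  = cong (∀' y) (ren-[/] ρ A x a)
ren-[/] ρ (∃' y A)    x a with y ≟ x
... | yes _ = refl
... | no _  = cong (∃' y) (ren-[/] ρ A x a)

AgreeOn : (Par → Set) → (Par → Par) → (Par → Par) → Set
AgreeOn P ρ σ = ∀ a → P a → ρ a ≡ σ a

renTerms-cong : ∀ {ρ σ} ts → AgreeOn (λ a → Any (OccT a) ts) ρ σ → renTerms ρ ts ≡ renTerms σ ts
renTerms-cong []           eq = refl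
renTerms-cong (var y ∷ ts) eq = cong (var y ∷_) (renTerms-cong ts (λ a o → eq a (there o)))
renTerms-cong (par b ∷ ts) eq =
  cong₂ _∷_ (cong par (eq b (here here))) (renTerms-cong ts (λ a o → eq a (there o)))

ren-cong : ∀ {ρ σ} A → AgreeOn (λ a → Occ a A) ρ σ → ren ρ A ≡ ren σ A
ren-cong (atom p ts) eq = cong (atom p) (renTerms-cong ts (λ a o → eq a (atm o)))
ren-cong ⊥'          eq = refl
ren-cong (A ∧' B)    eq = cong₂ _∧'_ (ren-cong A (λ a o → eq a (∧ˡ o))) (ren-cong B (λ a o → eq a (∧ʳ o)))
ren-cong (A ∨' B)    eq = cong₂ _∨'_ (ren-cong A (λ a o → eq a (∨ˡ o))) (ren-cong B (λ a o → eq a (∨ʳ o)))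
ren-cong (A ⊃ B)     eq = cong₂ _⊃_ (ren-cong A (λ a o → eq a (⊃ˡ o))) (ren-cong B (λ a o → eq a (⊃ʳ o)))
ren-cong (∀' y A)    eq = cong (∀' y) (ren-cong A (λ a o → eq a (∀o o)))
ren-cong (∃' y A)    eq = cong (∃' y) (ren-cong A (λ a o → eq a (∃o o)))

renList-cong : ∀ {ρ σ} Γ → AgreeOn (λ a → Any (Occ a) Γ) ρ σ → renList ρ Γ ≡ renList σ Γ
renList-cong []      eq = refl
renList-cong (A ∷ Γ) eq = cong₂ _∷_ (ren-cong A (λ a o → eq a (here o))) (renList-cong Γ (λ a o → eq a (there o)))

renComp-cong : ∀ {ρ σ} c → AgreeOn (λ a → OccC a c) ρ σ → renComp ρ c ≡ renComp σ c
renComp-cong (Γ ⊢ Δ) eq =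
  cong₂ _⊢_ (renList-cong Γ (λ a o → eq a (inj₁ o))) (renList-cong Δ (λ a o → eq a (inj₂ o)))

renTerms-id : ∀ ts → renTerms (λ a → a) ts ≡ ts
renTerms-id []           = refl
renTerms-id (var y ∷ ts) = cong (var y ∷_) (renTerms-id ts)
renTerms-id (par b ∷ ts) = cong (par b ∷_) (renTerms-id ts)

ren-id : ∀ A → ren (λ a → a) A ≡ A
ren-id (atom p ts) = cong (atom p) (renTerms-id ts)
ren-id ⊥'          = refl
ren-id (A ∧' B)    = cong₂ _∧'_ (ren-id A) (ren-id B)
ren-id (A ∨' B)    = cong₂ _∨'_ (ren-id A) (ren-id B)
ren-id (A ⊃ B)     = cong₂ _⊃_ (ren-id A) (ren-id B)
ren-id (∀' y A)    = cong (∀' y) (ren-id A)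
ren-id (∃' y A)    = cong (∃' y) (ren-id A)

renList-id : ∀ Γ → renList (λ a → a) Γ ≡ Γ
renList-id []      = refl
renList-id (A ∷ Γ) = cong₂ _∷_ (ren-id A) (renList-id Γ)

renComp-id : ∀ c → renComp (λ a → a) c ≡ c
renComp-id (Γ ⊢ Δ) = cong₂ _⊢_ (renList-id Γ) (renList-id Δ)

renComp-id-local : ∀ {ρ} c → AgreeOn (λ a → OccC a c) ρ (λ a → a) → renComp ρ c ≡ c
renComp-id-local c eq = trans (renComp-cong c eq) (renComp-id c)

renList-id-local : ∀ {ρ} Γ → AgreeOn (λ a → Any (Occ a) Γ) ρ (λ a → a) → renList ρ Γ ≡ Γ
renList-id-local Γ eq = trans (renList-cong Γ eq) (renList-id Γ)

ren-id-local : ∀ {ρ} A → AgreeOn (λ a → Occ a A) ρ (λ a → a) → ren ρ A ≡ A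
ren-id-local A eq = trans (ren-cong A eq) (ren-id A)

_[_↦_] : (Par → Par) → Par → Par → Par → Par
(ρ [ a ↦ b ]) c with c ≟ a
... | yes _ = b
... | no _  = ρ c

[↦]-≡ : ∀ ρ a b → (ρ [ a ↦ b ]) a ≡ b
[↦]-≡ ρ a b with a ≟ a
... | yes _  = refl
... | no a≢a = ⊥-elim (a≢a refl)

[↦]-≢ : ∀ ρ {a} b {c} → ¬ c ≡ a → (ρ [ a ↦ b ]) c ≡ ρ c
[↦]-≢ ρ {a} b {c} c≢a with c ≟ a
... | yes c≡a = ⊥-elim (c≢a c≡a)
... | no _    = refl

[↦]-agree : ∀ ρ {a} b {P : Par → Set} → ¬ P a → AgreeOn P (ρ [ a ↦ b ]) ρ
[↦]-agree ρ b ¬Pa c Pc = [↦]-≢ ρ b λ { refl → ¬Pa Pc }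

ren-[↦]-[/] : ∀ ρ {a} b {x} A → ren (ρ [ a ↦ b ]) (A [ a / x ]) ≡ ren (ρ [ a ↦ b ]) A [ b / x ]
ren-[↦]-[/] ρ {a} b {x} A =
  trans (ren-[/] (ρ [ a ↦ b ]) A x a) (cong (λ c → ren (ρ [ a ↦ b ]) A [ c / x ]) ([↦]-≡ ρ a b))

maxParTerms : List Term → ℕ
maxParTerms []           = 0
maxParTerms (var y ∷ ts) = maxParTerms ts
maxParTerms (par b ∷ ts) = b ⊔ maxParTerms ts

maxPar : Formula → ℕ
maxPar (atom p ts) = maxParTerms ts
maxPar ⊥'          = 0
maxPar (A ∧' B)    = maxPar A ⊔ maxPar B
maxPar (A ∨' B)    = maxPar A ⊔ maxPar B
maxPar (A ⊃ B)     = maxPar A ⊔ maxPar B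
maxPar (∀' y A)    = maxPar A
maxPar (∃' y A)    = maxPar A

maxParList : Multiset → ℕ
maxParList []      = 0
maxParList (A ∷ Γ) = maxPar A ⊔ maxParList Γ

maxParLNS : LNS → ℕ
maxParLNS []            = 0
maxParLNS ((Γ ⊢ Δ) ∷ S) = (maxParList Γ ⊔ maxParList Δ) ⊔ maxParLNS S

OccTs⇒≤ : ∀ {a} ts → Any (OccT a) ts → a ≤ maxParTerms ts
OccTs⇒≤ (var y ∷ ts) (there o)    = OccTs⇒≤ ts o
OccTs⇒≤ (par b ∷ ts) (here here)  = m≤m⊔n b (maxParTerms ts)
OccTs⇒≤ (par b ∷ ts) (there o)    = ≤-trans (OccTs⇒≤ ts o) (m≤n⊔m b (maxParTerms ts))

Occ⇒≤ : ∀ {a} A → Occ a A → a ≤ maxPar A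
Occ⇒≤ (atom p ts) (atm o) = OccTs⇒≤ ts o
Occ⇒≤ (A ∧' B) (∧ˡ o) = ≤-trans (Occ⇒≤ A o) (m≤m⊔n _ _)
Occ⇒≤ (A ∧' B) (∧ʳ o) = ≤-trans (Occ⇒≤ B o) (m≤n⊔m _ _)
Occ⇒≤ (A ∨' B) (∨ˡ o) = ≤-trans (Occ⇒≤ A o) (m≤m⊔n _ _)
Occ⇒≤ (A ∨' B) (∨ʳ o) = ≤-trans (Occ⇒≤ B o) (m≤n⊔m _ _)
Occ⇒≤ (A ⊃ B)  (⊃ˡ o) = ≤-trans (Occ⇒≤ A o) (m≤m⊔n _ _)
Occ⇒≤ (A ⊃ B)  (⊃ʳ o) = ≤-trans (Occ⇒≤ B o) (m≤n⊔m _ _)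
Occ⇒≤ (∀' y A) (∀o o) = Occ⇒≤ A o
Occ⇒≤ (∃' y A) (∃o o) = Occ⇒≤ A o

OccList⇒≤ : ∀ {a} Γ → Any (Occ a) Γ → a ≤ maxParList Γ
OccList⇒≤ (A ∷ Γ) (here o)  = ≤-trans (Occ⇒≤ A o) (m≤m⊔n _ _)
OccList⇒≤ (A ∷ Γ) (there o) = ≤-trans (OccList⇒≤ Γ o) (m≤n⊔m _ _)

OccS⇒≤ : ∀ {a} S → OccS a S → a ≤ maxParLNS S
OccS⇒≤ ((Γ ⊢ Δ) ∷ S) (here (inj₁ o)) =
  ≤-trans (OccList⇒≤ Γ o) (≤-trans (m≤m⊔n (maxParList Γ) (maxParList Δ)) (m≤m⊔n _ (maxParLNS S)))
OccS⇒≤ ((Γ ⊢ Δ) ∷ S) (here (inj₂ o)) =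
  ≤-trans (OccList⇒≤ Δ o) (≤-trans (m≤n⊔m (maxParList Γ) (maxParList Δ)) (m≤m⊔n _ (maxParLNS S)))
OccS⇒≤ (c ∷ S) (there o) = ≤-trans (OccS⇒≤ S o) (m≤n⊔m _ _)

fresh : LNS → Par
fresh S = suc (maxParLNS S)

fresh-¬OccS : ∀ S → ¬ OccS (fresh S) S
fresh-¬OccS S o = <-irrefl refl (OccS⇒≤ S o)

-- Height-indexed derivations

data Initial : LNS → Set where
  atom-here  : ∀ {Γ Δ L p ts} → atom p ts ∈ Γ → atom p ts ∈ Δ → Initial ((Γ ⊢ Δ) ∷ L)
  atom-later : ∀ {Γ Δ L p ts} → atom p ts ∈ Γ → Any (λ c → atom p ts ∈ succ c) L → Initial ((Γ ⊢ Δ) ∷ L)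
  ⊥-here     : ∀ {Γ Δ L} → ⊥' ∈ Γ → Initial ((Γ ⊢ Δ) ∷ L)
  skip       : ∀ {c L} → Initial L → Initial (c ∷ L)

data LocalRule₁ : Component → Component → Set where
  l∧ : ∀ {Γ Γ' Δ A B} → Γ' ↭ (A ∧' B) ∷ Γ → LocalRule₁ (Γ' ⊢ Δ) (A ∷ B ∷ Γ ⊢ Δ)
  r∨ : ∀ {Γ Δ Δ' A B} → Δ' ↭ (A ∨' B) ∷ Δ → LocalRule₁ (Γ ⊢ Δ') (Γ ⊢ A ∷ B ∷ Δ)
  l∀ : ∀ {Γ Γ' Δ x A} a → Γ' ↭ ∀' x A ∷ Γ → LocalRule₁ (Γ' ⊢ Δ) ((A [ a / x ]) ∷ Γ' ⊢ Δ)
  r∃ : ∀ {Γ Δ Δ' x A} a → Δ' ↭ ∃' x A ∷ Δ → LocalRule₁ (Γ ⊢ Δ') (Γ ⊢ (A [ a / x ]) ∷ Δ')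

data LocalRule₂ : Component → Component → Component → Set where
  r∧ : ∀ {Γ Δ Δ' A B} → Δ' ↭ (A ∧' B) ∷ Δ → LocalRule₂ (Γ ⊢ Δ') (Γ ⊢ A ∷ Δ) (Γ ⊢ B ∷ Δ)
  l∨ : ∀ {Γ Γ' Δ A B} → Γ' ↭ (A ∨' B) ∷ Γ → LocalRule₂ (Γ' ⊢ Δ) (A ∷ Γ ⊢ Δ) (B ∷ Γ ⊢ Δ)
  l⊃ : ∀ {Γ Γ' Δ A B} → Γ' ↭ (A ⊃ B) ∷ Γ → LocalRule₂ (Γ' ⊢ Δ) (B ∷ Γ ⊢ Δ) (Γ' ⊢ A ∷ Δ)

-- Der n S: S has an LNIF derivation of height at most n, with initial
-- sequents recognised by membership rather than by permutation.
data Der : ℕ → LNS → Set where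
  initial : ∀ {n S} → Initial S → Der n S
  local₁  : ∀ {n} G H {c c₁} → LocalRule₁ c c₁ → Der n (G ++ c₁ ∷ H) → Der (suc n) (G ++ c ∷ H)
  local₂  : ∀ {n} G H {c c₁ c₂} → LocalRule₂ c c₁ c₂ →
            Der n (G ++ c₁ ∷ H) → Der n (G ++ c₂ ∷ H) → Der (suc n) (G ++ c ∷ H)
  ∃l  : ∀ {n} G H Γ Δ Γ' x A a → Γ' ↭ ∃' x A ∷ Γ → ¬ OccS a (G ++ (Γ' ⊢ Δ) ∷ H) →
        Der n (G ++ ((A [ a / x ]) ∷ Γ ⊢ Δ) ∷ H) → Der (suc n) (G ++ (Γ' ⊢ Δ) ∷ H)
  ⊃r₁ : ∀ {n} G Γ Δ Δ' A B → Δ' ↭ (A ⊃ B) ∷ Δ →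
        Der n (G ++ (Γ ⊢ Δ) ∷ [ [ A ] ⊢ [ B ] ]) → Der (suc n) (G ++ [ Γ ⊢ Δ' ])
  ∀r₁ : ∀ {n} G Γ Δ Δ' x A a → Δ' ↭ ∀' x A ∷ Δ → ¬ OccS a (G ++ [ Γ ⊢ Δ' ]) →
        Der n (G ++ (Γ ⊢ Δ) ∷ [ [] ⊢ [ A [ a / x ] ] ]) → Der (suc n) (G ++ [ Γ ⊢ Δ' ])
  lift : ∀ {n} G H Γ₁ Δ₁ Γ₂ Δ₂ A → A ∈ Γ₁ →
         Der n (G ++ (Γ₁ ⊢ Δ₁) ∷ (A ∷ Γ₂ ⊢ Δ₂) ∷ H) →
         Der (suc n) (G ++ (Γ₁ ⊢ Δ₁) ∷ (Γ₂ ⊢ Δ₂) ∷ H)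
  ⊃r₂ : ∀ {n} G H Γ₁ Δ₁ Γ₂ Δ₂ Δ₁' A B → Δ₁' ↭ (A ⊃ B) ∷ Δ₁ →
        Der n (G ++ (Γ₁ ⊢ Δ₁) ∷ ([ A ] ⊢ [ B ]) ∷ (Γ₂ ⊢ Δ₂) ∷ H) →
        Der n (G ++ (Γ₁ ⊢ Δ₁) ∷ (Γ₂ ⊢ (A ⊃ B) ∷ Δ₂) ∷ H) →
        Der (suc n) (G ++ (Γ₁ ⊢ Δ₁') ∷ (Γ₂ ⊢ Δ₂) ∷ H)
  ∀r₂ : ∀ {n} G H Γ₁ Δ₁ Γ₂ Δ₂ Δ₁' x A a → Δ₁' ↭ ∀' x A ∷ Δ₁ →
        ¬ OccS a (G ++ (Γ₁ ⊢ Δ₁') ∷ (Γ₂ ⊢ Δ₂) ∷ H) →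
        Der n (G ++ (Γ₁ ⊢ Δ₁) ∷ ([] ⊢ [ A [ a / x ] ]) ∷ (Γ₂ ⊢ Δ₂) ∷ H) →
        Der n (G ++ (Γ₁ ⊢ Δ₁) ∷ (Γ₂ ⊢ ∀' x A ∷ Δ₂) ∷ H) →
        Der (suc n) (G ++ (Γ₁ ⊢ Δ₁') ∷ (Γ₂ ⊢ Δ₂) ∷ H)

Der-mono : ∀ {m n S} → m ≤ n → Der m S → Der n S
Der-mono _ (initial i) = initial i
Der-mono (s≤s m≤n) (local₁ G H r d) = local₁ G H r (Der-mono m≤n d)
Der-mono (s≤s m≤n) (local₂ G H r d e) = local₂ G H r (Der-mono m≤n d) (Der-mono m≤n e)
Der-mono (s≤s m≤n) (∃l G H Γ Δ Γ' x A a p f d) = ∃l G H Γ Δ Γ' x A a p f (Der-mono m≤n d)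
Der-mono (s≤s m≤n) (⊃r₁ G Γ Δ Δ' A B p d) = ⊃r₁ G Γ Δ Δ' A B p (Der-mono m≤n d)
Der-mono (s≤s m≤n) (∀r₁ G Γ Δ Δ' x A a p f d) = ∀r₁ G Γ Δ Δ' x A a p f (Der-mono m≤n d)
Der-mono (s≤s m≤n) (lift G H Γ₁ Δ₁ Γ₂ Δ₂ A A∈ d) = lift G H Γ₁ Δ₁ Γ₂ Δ₂ A A∈ (Der-mono m≤n d)
Der-mono (s≤s m≤n) (⊃r₂ G H Γ₁ Δ₁ Γ₂ Δ₂ Δ₁' A B p d e) =
  ⊃r₂ G H Γ₁ Δ₁ Γ₂ Δ₂ Δ₁' A B p (Der-mono m≤n d) (Der-mono m≤n e)
Der-mono (s≤s m≤n) (∀r₂ G H Γ₁ Δ₁ Γ₂ Δ₂ Δ₁' x A a p f d e) =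
  ∀r₂ G H Γ₁ Δ₁ Γ₂ Δ₂ Δ₁' x A a p f (Der-mono m≤n d) (Der-mono m≤n e)

Der-suc : ∀ {n S} → Der n S → Der (suc n) S
Der-suc = Der-mono (n≤1+n _)

Derivable : LNS → Set
Derivable S = ∃ λ n → Der n S

by₁ : ∀ {S₁ S} → Derivable S₁ → (∀ {n} → Der n S₁ → Der (suc n) S) → Derivable S
by₁ (n , d) rule = suc n , rule d

by₂ : ∀ {S₁ S₂ S} → Derivable S₁ → Derivable S₂ →
      (∀ {n} → Der n S₁ → Der n S₂ → Der (suc n) S) → Derivable S
by₂ (m , d) (n , e) rule = suc (m ⊔ n) , rule (Der-mono (m≤m⊔n m n) d) (Der-mono (m≤n⊔m m n) e)

module _ (G : LNS) (c : Component) (L : LNS) where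

  Der-assocʳ : ∀ {n} → Der n (G ++ c ∷ L) → Der n ((G ++ [ c ]) ++ L)
  Der-assocʳ = subst (Der _) (sym (++-assoc G [ c ] L))

  Der-assocˡ : ∀ {n} → Der n ((G ++ [ c ]) ++ L) → Der n (G ++ c ∷ L)
  Der-assocˡ = subst (Der _) (++-assoc G [ c ] L)

  Derivable-assocʳ : Derivable (G ++ c ∷ L) → Derivable ((G ++ [ c ]) ++ L)
  Derivable-assocʳ = subst Derivable (sym (++-assoc G [ c ] L))

  Derivable-assocˡ : Derivable ((G ++ [ c ]) ++ L) → Derivable (G ++ c ∷ L)
  Derivable-assocˡ = subst Derivable (++-assoc G [ c ] L)

Initial⇒LNIF : ∀ G {L} → Initial L → LNIF (G ++ L)
Initial⇒LNIF G (atom-here {Γ} {Δ} {L} {p} {ts} pΓ pΔ) with ∈⇒↭ pΓ | ∈⇒↭ pΔ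
... | Γ₀ , Γ↭ | Δ₀ , Δ↭ = id₁ G L Γ₀ Δ₀ Γ Δ p ts Γ↭ Δ↭
Initial⇒LNIF G (atom-later {Γ} {Δ} {p = p} {ts} pΓ pL) with ∈⇒↭ pΓ | Any-split pL
... | Γ₀ , Γ↭ | H , F , Γ₂ ⊢ Δ₂ , refl , pΔ₂ with ∈⇒↭ pΔ₂
...   | Δ₀ , Δ↭ = id₂ G H F Γ₀ Δ Γ₂ Δ₀ Γ Δ₂ p ts Γ↭ Δ↭
Initial⇒LNIF G (⊥-here {Γ} {Δ} {L} ⊥Γ) with ∈⇒↭ ⊥Γ
... | Γ₀ , Γ↭ = ⊥l G L Γ₀ Δ Γ Γ↭
Initial⇒LNIF G (skip {c} {L} i) = subst LNIF (++-assoc G [ c ] L) (Initial⇒LNIF (G ++ [ c ]) i)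

Der⇒LNIF : ∀ {n S} → Der n S → LNIF S
Der⇒LNIF (initial i) = Initial⇒LNIF [] i
Der⇒LNIF (local₁ G H (l∧ {Γ} {Γ'} {Δ} {A} {B} p) d) = ∧l G H Γ Δ Γ' A B p (Der⇒LNIF d)
Der⇒LNIF (local₁ G H (r∨ {Γ} {Δ} {Δ'} {A} {B} p) d) = ∨r G H Γ Δ Δ' A B p (Der⇒LNIF d)
Der⇒LNIF (local₁ G H (l∀ {Γ} {Γ'} {Δ} {x} {A} a p) d) = ∀l G H Γ Δ Γ' x A a p (Der⇒LNIF d)
Der⇒LNIF (local₁ G H (r∃ {Γ} {Δ} {Δ'} {x} {A} a p) d) = ∃r G H Γ Δ Δ' x A a p (Der⇒LNIF d)
Der⇒LNIF (local₂ G H (r∧ {Γ} {Δ} {Δ'} {A} {B} p) d e) = ∧r G H Γ Δ Δ' A B p (Der⇒LNIF d) (Der⇒LNIF e)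
Der⇒LNIF (local₂ G H (l∨ {Γ} {Γ'} {Δ} {A} {B} p) d e) = ∨l G H Γ Δ Γ' A B p (Der⇒LNIF d) (Der⇒LNIF e)
Der⇒LNIF (local₂ G H (l⊃ {Γ} {Γ'} {Δ} {A} {B} p) d e) = ⊃l G H Γ Δ Γ' A B p (Der⇒LNIF d) (Der⇒LNIF e)
Der⇒LNIF (∃l G H Γ Δ Γ' x A a p f d) = ∃l G H Γ Δ Γ' x A a p f (Der⇒LNIF d)
Der⇒LNIF (⊃r₁ G Γ Δ Δ' A B p d) = ⊃r₁ G Γ Δ Δ' A B p (Der⇒LNIF d)
Der⇒LNIF (∀r₁ G Γ Δ Δ' x A a p f d) = ∀r₁ G Γ Δ Δ' x A a p f (Der⇒LNIF d)
Der⇒LNIF (lift G H Γ₁ Δ₁ Γ₂ Δ₂ A A∈ d) with ∈⇒↭ A∈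
... | Γ₀ , Γ↭ = lift G H Γ₀ Δ₁ Γ₂ Δ₂ Γ₁ A Γ↭ (Der⇒LNIF d)
Der⇒LNIF (⊃r₂ G H Γ₁ Δ₁ Γ₂ Δ₂ Δ₁' A B p d e) =
  ⊃r₂ G H Γ₁ Δ₁ Γ₂ Δ₂ Δ₁' A B p (Der⇒LNIF d) (Der⇒LNIF e)
Der⇒LNIF (∀r₂ G H Γ₁ Δ₁ Γ₂ Δ₂ Δ₁' x A a p f d e) =
  ∀r₂ G H Γ₁ Δ₁ Γ₂ Δ₂ Δ₁' x A a p f (Der⇒LNIF d) (Der⇒LNIF e)

Initial-++ : ∀ G {L} → Initial L → Initial (G ++ L)
Initial-++ []      i = i
Initial-++ (c ∷ G) i = skip (Initial-++ G i)

LNIF⇒Derivable : ∀ {S} → LNIF S → Derivable S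
LNIF⇒Derivable (id₁ G H Γ Δ Γ' Δ' p ts Γ↭ Δ↭) =
  0 , initial (Initial-++ G (atom-here (↭∷⇒∈ Γ↭) (↭∷⇒∈ Δ↭)))
LNIF⇒Derivable (id₂ G H F Γ₁ Δ₁ Γ₂ Δ₂ Γ₁' Δ₂' p ts Γ↭ Δ↭) =
  0 , initial (Initial-++ G (atom-later (↭∷⇒∈ Γ↭) (Any-mid H (↭∷⇒∈ Δ↭))))
LNIF⇒Derivable (⊥l G H Γ Δ Γ' Γ↭) = 0 , initial (Initial-++ G (⊥-here (↭∷⇒∈ Γ↭)))
LNIF⇒Derivable (∧l G H Γ Δ Γ' A B p d) = by₁ (LNIF⇒Derivable d) (local₁ G H (l∧ p))
LNIF⇒Derivable (∨r G H Γ Δ Δ' A B p d) = by₁ (LNIF⇒Derivable d) (local₁ G H (r∨ p))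
LNIF⇒Derivable (∧r G H Γ Δ Δ' A B p d e) = by₂ (LNIF⇒Derivable d) (LNIF⇒Derivable e) (local₂ G H (r∧ p))
LNIF⇒Derivable (∨l G H Γ Δ Γ' A B p d e) = by₂ (LNIF⇒Derivable d) (LNIF⇒Derivable e) (local₂ G H (l∨ p))
LNIF⇒Derivable (⊃r₁ G Γ Δ Δ' A B p d) = by₁ (LNIF⇒Derivable d) (⊃r₁ G Γ Δ Δ' A B p)
LNIF⇒Derivable (⊃l G H Γ Δ Γ' A B p d e) = by₂ (LNIF⇒Derivable d) (LNIF⇒Derivable e) (local₂ G H (l⊃ p))
LNIF⇒Derivable (lift G H Γ₁ Δ₁ Γ₂ Δ₂ Γ₁' A p d) =
  by₁ (LNIF⇒Derivable d) (lift G H Γ₁' Δ₁ Γ₂ Δ₂ A (↭∷⇒∈ p))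
LNIF⇒Derivable (∀l G H Γ Δ Γ' x A a p d) = by₁ (LNIF⇒Derivable d) (local₁ G H (l∀ a p))
LNIF⇒Derivable (∀r₁ G Γ Δ Δ' x A a p f d) = by₁ (LNIF⇒Derivable d) (∀r₁ G Γ Δ Δ' x A a p f)
LNIF⇒Derivable (∃l G H Γ Δ Γ' x A a p f d) = by₁ (LNIF⇒Derivable d) (∃l G H Γ Δ Γ' x A a p f)
LNIF⇒Derivable (∃r G H Γ Δ Δ' x A a p d) = by₁ (LNIF⇒Derivable d) (local₁ G H (r∃ a p))
LNIF⇒Derivable (⊃r₂ G H Γ₁ Δ₁ Γ₂ Δ₂ Δ₁' A B p d e) =
  by₂ (LNIF⇒Derivable d) (LNIF⇒Derivable e) (⊃r₂ G H Γ₁ Δ₁ Γ₂ Δ₂ Δ₁' A B p)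
LNIF⇒Derivable (∀r₂ G H Γ₁ Δ₁ Γ₂ Δ₂ Δ₁' x A a p f d e) =
  by₂ (LNIF⇒Derivable d) (LNIF⇒Derivable e) (∀r₂ G H Γ₁ Δ₁ Γ₂ Δ₂ Δ₁' x A a p f)

-- Height-preserving weakening and renaming

_⊆ₘ_ : Multiset → Multiset → Set
Γ ⊆ₘ Γ' = ∃ λ X → Γ' ↭ Γ ++ X

_⊑_ : Component → Component → Set
c ⊑ c' = ant c ⊆ₘ ant c' × succ c ⊆ₘ succ c'

Weakening : (Par → Par) → LNS → LNS → Set
Weakening ρ = Pointwise (λ c c' → renComp ρ c ⊑ c')

⊆ₘ-refl : ∀ Γ → Γ ⊆ₘ Γ
⊆ₘ-refl Γ = [] , ↭-sym (↭.++-identityʳ Γ)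

⊆ₘ-↭ : ∀ {Γ Γ'} → Γ' ↭ Γ → Γ ⊆ₘ Γ'
⊆ₘ-↭ {Γ} p = [] , ↭-trans p (↭-sym (↭.++-identityʳ Γ))

≡⇒⊑ : ∀ {c c'} → c ≡ c' → c ⊑ c'
≡⇒⊑ {Γ ⊢ Δ} refl = ⊆ₘ-refl Γ , ⊆ₘ-refl Δ

id-⊑ : ∀ {Γ Δ Γ' Δ'} → Γ ⊆ₘ Γ' → Δ ⊆ₘ Δ' → renComp (λ a → a) (Γ ⊢ Δ) ⊑ (Γ' ⊢ Δ')
id-⊑ {Γ} {Δ} Γ⊆ Δ⊆ = subst (_⊆ₘ _) (sym (renList-id Γ)) Γ⊆ , subst (_⊆ₘ _) (sym (renList-id Δ)) Δ⊆

Weakening-id-local : ∀ {ρ} S → AgreeOn (λ a → OccS a S) ρ (λ a → a) → Weakening ρ S S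
Weakening-id-local []      eq = []
Weakening-id-local (c ∷ S) eq =
  ≡⇒⊑ (renComp-id-local c (λ a o → eq a (here o))) ∷ Weakening-id-local S (λ a o → eq a (there o))

Weakening-refl : ∀ S → Weakening (λ a → a) S S
Weakening-refl S = Weakening-id-local S (λ _ _ → refl)

Weakening-cong : ∀ {ρ σ S S'} → AgreeOn (λ a → OccS a S) ρ σ → Weakening ρ S S' → Weakening σ S S'
Weakening-cong eq [] = []
Weakening-cong {S = c ∷ S} eq (c⊑ ∷ w) =
  subst (_⊑ _) (renComp-cong c (λ a o → eq a (here o))) c⊑ ∷ Weakening-cong (λ a o → eq a (there o)) w

Weakening-split : ∀ {ρ} G {c H S'} → Weakening ρ (G ++ c ∷ H) S' →
                  ∃₂ λ G' H' → Σ Component λ c' →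
                  S' ≡ G' ++ c' ∷ H' × Weakening ρ G G' × renComp ρ c ⊑ c' × Weakening ρ H H'
Weakening-split []      (c⊑ ∷ w) = [] , _ , _ , refl , [] , c⊑ , w
Weakening-split (g ∷ G) (g⊑ ∷ w) with Weakening-split G w
... | G' , H' , c' , refl , wG , c⊑ , wH = _ ∷ G' , H' , c' , refl , g⊑ ∷ wG , c⊑ , wH

⊆ₘ-principal : ∀ {ρ Γ Γ' X A Γ₀} → Γ' ↭ renList ρ Γ ++ X → Γ ↭ A ∷ Γ₀ →
               Γ' ↭ ren ρ A ∷ (renList ρ Γ₀ ++ X)
⊆ₘ-principal {ρ} {X = X} p q = ↭-trans p (↭.++⁺ʳ X (↭.map⁺ (ren ρ) q))

∈-⊆ₘ : ∀ {ρ A Γ Γ'} → A ∈ Γ → renList ρ Γ ⊆ₘ Γ' → ren ρ A ∈ Γ'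
∈-⊆ₘ {ρ} A∈ (X , p) = ↭.∈-resp-↭ (↭-sym p) (∈.∈-++⁺ˡ (∈.∈-map⁺ (ren ρ) A∈))

Initial-weaken : ∀ {ρ S S'} → Initial S → Weakening ρ S S' → Initial S'
Initial-weaken (atom-here pΓ pΔ) ((Γ⊆ , Δ⊆) ∷ w) = atom-here (∈-⊆ₘ pΓ Γ⊆) (∈-⊆ₘ pΔ Δ⊆)
Initial-weaken (atom-later pΓ pL) ((Γ⊆ , _) ∷ w) = atom-later (∈-⊆ₘ pΓ Γ⊆) (later pL w)
  where
  later : ∀ {ρ A L L'} → Any (λ c → A ∈ succ c) L → Weakening ρ L L' → Any (λ c → ren ρ A ∈ succ c) L'
  later (here pΔ) ((_ , Δ⊆) ∷ w) = here (∈-⊆ₘ pΔ Δ⊆)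
  later (there pL) (_ ∷ w)       = there (later pL w)
Initial-weaken (⊥-here pΓ) ((Γ⊆ , _) ∷ w) = ⊥-here (∈-⊆ₘ pΓ Γ⊆)
Initial-weaken (skip i) (_ ∷ w) = skip (Initial-weaken i w)

LocalRule₁-weaken : ∀ {ρ c c₁ c'} → LocalRule₁ c c₁ → renComp ρ c ⊑ c' →
                    Σ Component λ c₁' → LocalRule₁ c' c₁' × renComp ρ c₁ ⊑ c₁'
LocalRule₁-weaken (l∧ p) ((X , Γ↭) , Δ⊆) = _ , l∧ (⊆ₘ-principal Γ↭ p) , (X , ↭-refl) , Δ⊆
LocalRule₁-weaken (r∨ p) (Γ⊆ , (Y , Δ↭)) = _ , r∨ (⊆ₘ-principal Δ↭ p) , Γ⊆ , (Y , ↭-refl)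
LocalRule₁-weaken {ρ} (l∀ {A = A} a p) ((X , Γ↭) , Δ⊆) =
  _ , l∀ (ρ a) (⊆ₘ-principal Γ↭ p) , (X , ↭-∷-≡ (sym (ren-[/] ρ A _ a)) Γ↭) , Δ⊆
LocalRule₁-weaken {ρ} (r∃ {A = A} a p) (Γ⊆ , (Y , Δ↭)) =
  _ , r∃ (ρ a) (⊆ₘ-principal Δ↭ p) , Γ⊆ , (Y , ↭-∷-≡ (sym (ren-[/] ρ A _ a)) Δ↭)

LocalRule₂-weaken : ∀ {ρ c c₁ c₂ c'} → LocalRule₂ c c₁ c₂ → renComp ρ c ⊑ c' →
                    ∃₂ λ c₁' c₂' → LocalRule₂ c' c₁' c₂' × renComp ρ c₁ ⊑ c₁' × renComp ρ c₂ ⊑ c₂'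
LocalRule₂-weaken (r∧ p) (Γ⊆ , (Y , Δ↭)) =
  _ , _ , r∧ (⊆ₘ-principal Δ↭ p) , (Γ⊆ , (Y , ↭-refl)) , (Γ⊆ , (Y , ↭-refl))
LocalRule₂-weaken (l∨ p) ((X , Γ↭) , Δ⊆) =
  _ , _ , l∨ (⊆ₘ-principal Γ↭ p) , ((X , ↭-refl) , Δ⊆) , ((X , ↭-refl) , Δ⊆)
LocalRule₂-weaken (l⊃ p) ((X , Γ↭) , (Y , Δ↭)) =
  _ , _ , l⊃ (⊆ₘ-principal Γ↭ p) , ((X , ↭-refl) , (Y , Δ↭)) , ((X , Γ↭) , (Y , ↭-prep _ Δ↭))

Weakening-[↦] : ∀ {ρ a S S'} b → ¬ OccS a S → Weakening ρ S S' → Weakening (ρ [ a ↦ b ]) S S'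
Weakening-[↦] {ρ} b a∉ = Weakening-cong (λ c o → sym ([↦]-agree ρ b a∉ c o))

⊑-eigen : ∀ ρ {a} b {x} A → renComp (ρ [ a ↦ b ]) ([] ⊢ [ A [ a / x ] ]) ⊑ ([] ⊢ [ ren (ρ [ a ↦ b ]) A [ b / x ] ])
⊑-eigen ρ b A = ≡⇒⊑ (cong (λ F → [] ⊢ [ F ]) (ren-[↦]-[/] ρ b A))

-- Eigenvariables are sent to parameters fresh for the target, so that their
-- conditions survive the weakening.
weaken : ∀ {n S} → Der n S → ∀ ρ {S'} → Weakening ρ S S' → Der n S'
weaken (initial i) ρ w = initial (Initial-weaken i w)
weaken (local₁ G H r d) ρ w with Weakening-split G w
... | G' , H' , c' , refl , wG , c⊑ , wH with LocalRule₁-weaken r c⊑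
...   | _ , r' , c₁⊑ = local₁ G' H' r' (weaken d ρ (Pw.++⁺ wG (c₁⊑ ∷ wH)))
weaken (local₂ G H r d e) ρ w with Weakening-split G w
... | G' , H' , c' , refl , wG , c⊑ , wH with LocalRule₂-weaken r c⊑
...   | _ , _ , r' , c₁⊑ , c₂⊑ =
  local₂ G' H' r' (weaken d ρ (Pw.++⁺ wG (c₁⊑ ∷ wH))) (weaken e ρ (Pw.++⁺ wG (c₂⊑ ∷ wH)))
weaken (∃l G H Γ Δ Γ' x A a p a∉ d) ρ {S'} w
  with Weakening-split G (Weakening-[↦] (fresh S') a∉ w)
... | G' , H' , c' , refl , wG , ((X , Γ↭) , Δ⊆) , wH =
  ∃l G' H' (renList σ Γ ++ X) (succ c') (ant c') x (ren σ A) b (⊆ₘ-principal Γ↭ p) (fresh-¬OccS _)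
     (weaken d σ (Pw.++⁺ wG (((X , ↭-∷-≡ (sym (ren-[↦]-[/] ρ b A)) ↭-refl) , Δ⊆) ∷ wH)))
  where b = fresh (G' ++ c' ∷ H')
        σ = ρ [ a ↦ b ]
weaken (⊃r₁ G Γ Δ Δ' A B p d) ρ w with Weakening-split G w
... | G' , [] , c' , refl , wG , (Γ⊆ , (Y , Δ↭)) , [] =
  ⊃r₁ G' (ant c') (renList ρ Δ ++ Y) (succ c') (ren ρ A) (ren ρ B) (⊆ₘ-principal Δ↭ p)
      (weaken d ρ (Pw.++⁺ wG ((Γ⊆ , (Y , ↭-refl)) ∷ ≡⇒⊑ refl ∷ [])))
weaken (∀r₁ G Γ Δ Δ' x A a p a∉ d) ρ {S'} w
  with Weakening-split G (Weakening-[↦] (fresh S') a∉ w)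
... | G' , [] , c' , refl , wG , (Γ⊆ , (Y , Δ↭)) , [] =
  ∀r₁ G' (ant c') (renList σ Δ ++ Y) (succ c') x (ren σ A) b (⊆ₘ-principal Δ↭ p) (fresh-¬OccS _)
      (weaken d σ (Pw.++⁺ wG ((Γ⊆ , (Y , ↭-refl)) ∷ ⊑-eigen ρ b A ∷ [])))
  where b = fresh (G' ++ [ c' ])
        σ = ρ [ a ↦ b ]
weaken (lift G H Γ₁ Δ₁ Γ₂ Δ₂ A A∈ d) ρ w with Weakening-split G w
... | G' , c₂' ∷ H' , c₁' , refl , wG , c₁⊑ , ((X , Γ↭) , Δ⊆) ∷ wH =
  lift G' H' (ant c₁') (succ c₁') (ant c₂') (succ c₂') (ren ρ A) (∈-⊆ₘ A∈ (proj₁ c₁⊑))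
       (weaken d ρ (Pw.++⁺ wG (c₁⊑ ∷ ((X , ↭-prep _ Γ↭) , Δ⊆) ∷ wH)))
weaken (⊃r₂ G H Γ₁ Δ₁ Γ₂ Δ₂ Δ₁' A B p d e) ρ w with Weakening-split G w
... | G' , c₂' ∷ H' , c₁' , refl , wG , (Γ₁⊆ , (Y , Δ↭)) , (Γ₂⊆ , (Z , Δ₂↭)) ∷ wH =
  ⊃r₂ G' H' (ant c₁') (renList ρ Δ₁ ++ Y) (ant c₂') (succ c₂') (succ c₁') (ren ρ A) (ren ρ B)
      (⊆ₘ-principal Δ↭ p)
      (weaken d ρ (Pw.++⁺ wG ((Γ₁⊆ , (Y , ↭-refl)) ∷ ≡⇒⊑ refl ∷ (Γ₂⊆ , (Z , Δ₂↭)) ∷ wH)))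
      (weaken e ρ (Pw.++⁺ wG ((Γ₁⊆ , (Y , ↭-refl)) ∷ (Γ₂⊆ , (Z , ↭-prep _ Δ₂↭)) ∷ wH)))
weaken (∀r₂ G H Γ₁ Δ₁ Γ₂ Δ₂ Δ₁' x A a p a∉ d e) ρ {S'} w
  with Weakening-split G (Weakening-[↦] (fresh S') a∉ w)
... | G' , c₂' ∷ H' , c₁' , refl , wG , (Γ₁⊆ , (Y , Δ↭)) , (Γ₂⊆ , (Z , Δ₂↭)) ∷ wH =
  ∀r₂ G' H' (ant c₁') (renList σ Δ₁ ++ Y) (ant c₂') (succ c₂') (succ c₁') x (ren σ A) b
      (⊆ₘ-principal Δ↭ p) (fresh-¬OccS _)
      (weaken d σ (Pw.++⁺ wG ((Γ₁⊆ , (Y , ↭-refl)) ∷ ⊑-eigen ρ b A ∷ (Γ₂⊆ , (Z , Δ₂↭)) ∷ wH)))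
      (weaken e σ (Pw.++⁺ wG ((Γ₁⊆ , (Y , ↭-refl)) ∷ (Γ₂⊆ , (Z , ↭-prep _ Δ₂↭)) ∷ wH)))
  where b = fresh (G' ++ c₁' ∷ c₂' ∷ H')
        σ = ρ [ a ↦ b ]

OccS-++ˡ : ∀ {a} G {S} → OccS a G → OccS a (G ++ S)
OccS-++ˡ G = Any.++⁺ˡ

OccS-++ʳ : ∀ {a} G {S} → OccS a S → OccS a (G ++ S)
OccS-++ʳ G = Any.++⁺ʳ G

OccS-mid : ∀ {a} G {c H} → OccC a c → OccS a (G ++ c ∷ H)
OccS-mid G o = Any.++⁺ʳ G (here o)

Occ-↭-∷ : ∀ {a Γ A Γ₀} → Γ ↭ A ∷ Γ₀ → Occ a A → Any (Occ a) Γ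
Occ-↭-∷ p o = ↭.Any-resp-↭ (↭-sym p) (here o)

Occs-↭-∷ : ∀ {a Γ A Γ₀} → Γ ↭ A ∷ Γ₀ → Any (Occ a) Γ₀ → Any (Occ a) Γ
Occs-↭-∷ p o = ↭.Any-resp-↭ (↭-sym p) (there o)

⟨_↦_⟩ : Par → Par → Par → Par
⟨ a ↦ b ⟩ = (λ c → c) [ a ↦ b ]

⟨↦⟩-id : ∀ {a} b {P : Par → Set} → ¬ P a → AgreeOn P ⟨ a ↦ b ⟩ (λ c → c)
⟨↦⟩-id = [↦]-agree (λ c → c)

ren-⟨↦⟩-[/] : ∀ {a} b {x} A → ¬ Occ a A → ren ⟨ a ↦ b ⟩ (A [ a / x ]) ≡ A [ b / x ]
ren-⟨↦⟩-[/] b {x} A a∉A =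
  trans (ren-[↦]-[/] (λ c → c) b A) (cong (_[ b / x ]) (ren-id-local A (⟨↦⟩-id b a∉A)))

Weakening-⟨↦⟩-id : ∀ {a} b S → ¬ OccS a S → Weakening ⟨ a ↦ b ⟩ S S
Weakening-⟨↦⟩-id b S a∉S = Weakening-id-local S (⟨↦⟩-id b a∉S)

module _ {n : ℕ} (G : LNS) {a : Par} (b : Par) where

  ∃l-rename : ∀ H Γ Δ Γ' x A → Γ' ↭ ∃' x A ∷ Γ → ¬ OccS a (G ++ (Γ' ⊢ Δ) ∷ H) →
              Der n (G ++ ((A [ a / x ]) ∷ Γ ⊢ Δ) ∷ H) → Der n (G ++ ((A [ b / x ]) ∷ Γ ⊢ Δ) ∷ H)
  ∃l-rename H Γ Δ Γ' x A p a∉ d =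
    weaken d ⟨ a ↦ b ⟩ (Pw.++⁺ (Weakening-⟨↦⟩-id b G (a∉ ∘ OccS-++ˡ G))
      (≡⇒⊑ (cong₂ _⊢_ (cong₂ _∷_ (ren-⟨↦⟩-[/] b A (a∉ ∘ OccS-mid G ∘ inj₁ ∘ Occ-↭-∷ p ∘ ∃o))
                                  (renList-id-local Γ (⟨↦⟩-id b (a∉ ∘ OccS-mid G ∘ inj₁ ∘ Occs-↭-∷ p))))
                      (renList-id-local Δ (⟨↦⟩-id b (a∉ ∘ OccS-mid G ∘ inj₂))))
       ∷ Weakening-⟨↦⟩-id b H (a∉ ∘ OccS-++ʳ G ∘ there)))

  ∀r₁-rename : ∀ Γ Δ Δ' x A → Δ' ↭ ∀' x A ∷ Δ → ¬ OccS a (G ++ [ Γ ⊢ Δ' ]) →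
               Der n (G ++ (Γ ⊢ Δ) ∷ [ [] ⊢ [ A [ a / x ] ] ]) → Der n (G ++ (Γ ⊢ Δ) ∷ [ [] ⊢ [ A [ b / x ] ] ])
  ∀r₁-rename Γ Δ Δ' x A p a∉ d =
    weaken d ⟨ a ↦ b ⟩ (Pw.++⁺ (Weakening-⟨↦⟩-id b G (a∉ ∘ OccS-++ˡ G))
      (≡⇒⊑ (cong₂ _⊢_ (renList-id-local Γ (⟨↦⟩-id b (a∉ ∘ OccS-mid G ∘ inj₁)))
                      (renList-id-local Δ (⟨↦⟩-id b (a∉ ∘ OccS-mid G ∘ inj₂ ∘ Occs-↭-∷ p))))
       ∷ ≡⇒⊑ (cong (λ F → [] ⊢ [ F ]) (ren-⟨↦⟩-[/] b A (a∉ ∘ OccS-mid G ∘ inj₂ ∘ Occ-↭-∷ p ∘ ∀o)))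
       ∷ []))

  ∀r₂-rename : ∀ H Γ₁ Δ₁ Γ₂ Δ₂ Δ₁' x A → Δ₁' ↭ ∀' x A ∷ Δ₁ →
               ¬ OccS a (G ++ (Γ₁ ⊢ Δ₁') ∷ (Γ₂ ⊢ Δ₂) ∷ H) →
               Der n (G ++ (Γ₁ ⊢ Δ₁) ∷ ([] ⊢ [ A [ a / x ] ]) ∷ (Γ₂ ⊢ Δ₂) ∷ H) →
               Der n (G ++ (Γ₁ ⊢ Δ₁) ∷ ([] ⊢ [ A [ b / x ] ]) ∷ (Γ₂ ⊢ Δ₂) ∷ H)
  ∀r₂-rename H Γ₁ Δ₁ Γ₂ Δ₂ Δ₁' x A p a∉ d =
    weaken d ⟨ a ↦ b ⟩ (Pw.++⁺ (Weakening-⟨↦⟩-id b G (a∉ ∘ OccS-++ˡ G))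
      (≡⇒⊑ (cong₂ _⊢_ (renList-id-local Γ₁ (⟨↦⟩-id b (a∉ ∘ OccS-mid G ∘ inj₁)))
                      (renList-id-local Δ₁ (⟨↦⟩-id b (a∉ ∘ OccS-mid G ∘ inj₂ ∘ Occs-↭-∷ p))))
       ∷ ≡⇒⊑ (cong (λ F → [] ⊢ [ F ]) (ren-⟨↦⟩-[/] b A (a∉ ∘ OccS-mid G ∘ inj₂ ∘ Occ-↭-∷ p ∘ ∀o)))
       ∷ Weakening-⟨↦⟩-id b ((Γ₂ ⊢ Δ₂) ∷ H) (a∉ ∘ OccS-++ʳ G ∘ there)))

module _ {n : ℕ} (G : LNS) where

  ∃l-fresh : ∀ H Γ Δ Γ' x A → Γ' ↭ ∃' x A ∷ Γ →
             (∀ b → Der n (G ++ ((A [ b / x ]) ∷ Γ ⊢ Δ) ∷ H)) → Der (suc n) (G ++ (Γ' ⊢ Δ) ∷ H)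
  ∃l-fresh H Γ Δ Γ' x A p d = ∃l G H Γ Δ Γ' x A b p (fresh-¬OccS _) (d b)
    where b = fresh (G ++ (Γ' ⊢ Δ) ∷ H)

  ∀r₁-fresh : ∀ Γ Δ Δ' x A → Δ' ↭ ∀' x A ∷ Δ →
              (∀ b → Der n (G ++ (Γ ⊢ Δ) ∷ [ [] ⊢ [ A [ b / x ] ] ])) → Der (suc n) (G ++ [ Γ ⊢ Δ' ])
  ∀r₁-fresh Γ Δ Δ' x A p d = ∀r₁ G Γ Δ Δ' x A b p (fresh-¬OccS _) (d b)
    where b = fresh (G ++ [ Γ ⊢ Δ' ])

  ∀r₂-fresh : ∀ H Γ₁ Δ₁ Γ₂ Δ₂ Δ₁' x A → Δ₁' ↭ ∀' x A ∷ Δ₁ →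
              (∀ b → Der n (G ++ (Γ₁ ⊢ Δ₁) ∷ ([] ⊢ [ A [ b / x ] ]) ∷ (Γ₂ ⊢ Δ₂) ∷ H)) →
              Der n (G ++ (Γ₁ ⊢ Δ₁) ∷ (Γ₂ ⊢ ∀' x A ∷ Δ₂) ∷ H) →
              Der (suc n) (G ++ (Γ₁ ⊢ Δ₁') ∷ (Γ₂ ⊢ Δ₂) ∷ H)
  ∀r₂-fresh H Γ₁ Δ₁ Γ₂ Δ₂ Δ₁' x A p d e = ∀r₂ G H Γ₁ Δ₁ Γ₂ Δ₂ Δ₁' x A b p (fresh-¬OccS _) (d b) e
    where b = fresh (G ++ (Γ₁ ⊢ Δ₁') ∷ (Γ₂ ⊢ Δ₂) ∷ H)

module _ (G : LNS) where

  ∃l-freshᴰ : ∀ H Γ Δ Γ' x A → Γ' ↭ ∃' x A ∷ Γ →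
              (∀ b → Derivable (G ++ ((A [ b / x ]) ∷ Γ ⊢ Δ) ∷ H)) → Derivable (G ++ (Γ' ⊢ Δ) ∷ H)
  ∃l-freshᴰ H Γ Δ Γ' x A p d = by₁ (d b) (∃l G H Γ Δ Γ' x A b p (fresh-¬OccS _))
    where b = fresh (G ++ (Γ' ⊢ Δ) ∷ H)

  ∀r₁-freshᴰ : ∀ Γ Δ Δ' x A → Δ' ↭ ∀' x A ∷ Δ →
               (∀ b → Derivable (G ++ (Γ ⊢ Δ) ∷ [ [] ⊢ [ A [ b / x ] ] ])) → Derivable (G ++ [ Γ ⊢ Δ' ])
  ∀r₁-freshᴰ Γ Δ Δ' x A p d = by₁ (d b) (∀r₁ G Γ Δ Δ' x A b p (fresh-¬OccS _))
    where b = fresh (G ++ [ Γ ⊢ Δ' ])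

  ∀r₂-freshᴰ : ∀ H Γ₁ Δ₁ Γ₂ Δ₂ Δ₁' x A → Δ₁' ↭ ∀' x A ∷ Δ₁ →
               (∀ b → Derivable (G ++ (Γ₁ ⊢ Δ₁) ∷ ([] ⊢ [ A [ b / x ] ]) ∷ (Γ₂ ⊢ Δ₂) ∷ H)) →
               Derivable (G ++ (Γ₁ ⊢ Δ₁) ∷ (Γ₂ ⊢ ∀' x A ∷ Δ₂) ∷ H) →
               Derivable (G ++ (Γ₁ ⊢ Δ₁') ∷ (Γ₂ ⊢ Δ₂) ∷ H)
  ∀r₂-freshᴰ H Γ₁ Δ₁ Γ₂ Δ₂ Δ₁' x A p d e =
    by₂ (d b) e (∀r₂ G H Γ₁ Δ₁ Γ₂ Δ₂ Δ₁' x A b p (fresh-¬OccS _))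
    where b = fresh (G ++ (Γ₁ ⊢ Δ₁') ∷ (Γ₂ ⊢ Δ₂) ∷ H)

-- Moving a succedent formula into the next component

data Shift (F : Formula) : LNS → LNS → Set where
  shift : ∀ {Γ Δ Δ₁ Γ₂ Δ₂ Δ₂' H} → Δ ↭ F ∷ Δ₁ → Δ₂' ↭ F ∷ Δ₂ →
          Shift F ((Γ ⊢ Δ) ∷ (Γ₂ ⊢ Δ₂) ∷ H) ((Γ ⊢ Δ₁) ∷ (Γ₂ ⊢ Δ₂') ∷ H)
  pass  : ∀ {c L L'} → Shift F L L' → Shift F (c ∷ L) (c ∷ L')

Shift-++⁺ˡ : ∀ {F G G'} X → Shift F G G' → Shift F (G ++ X) (G' ++ X)
Shift-++⁺ˡ X (shift p q) = shift p q
Shift-++⁺ˡ X (pass s)    = pass (Shift-++⁺ˡ X s)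

Shift-++⁺ʳ : ∀ {F H H'} G → Shift F H H' → Shift F (G ++ H) (G ++ H')
Shift-++⁺ʳ []      s = s
Shift-++⁺ʳ (c ∷ G) s = pass (Shift-++⁺ʳ G s)

shift-at : ∀ {F Γ Δ Δ₁ Γ₂ Δ₂ Δ₂'} G H → Δ ↭ F ∷ Δ₁ → Δ₂' ↭ F ∷ Δ₂ →
           Shift F (G ++ (Γ ⊢ Δ) ∷ (Γ₂ ⊢ Δ₂) ∷ H) (G ++ (Γ ⊢ Δ₁) ∷ (Γ₂ ⊢ Δ₂') ∷ H)
shift-at G H p q = Shift-++⁺ʳ G (shift p q)

shift-at-last : ∀ {F Γ Δ Δ₁ Γ₂ Δ₂ Δ₂'} G H → Δ ↭ F ∷ Δ₁ → Δ₂' ↭ F ∷ Δ₂ →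
                Shift F ((G ++ [ Γ ⊢ Δ ]) ++ (Γ₂ ⊢ Δ₂) ∷ H) ((G ++ [ Γ ⊢ Δ₁ ]) ++ (Γ₂ ⊢ Δ₂') ∷ H)
shift-at-last {Γ = Γ} {Δ} {Δ₁} {Γ₂} {Δ₂} {Δ₂'} G H p q
  rewrite ++-assoc G [ Γ ⊢ Δ ] ((Γ₂ ⊢ Δ₂) ∷ H) | ++-assoc G [ Γ ⊢ Δ₁ ] ((Γ₂ ⊢ Δ₂') ∷ H) = shift-at G H p q

data ShiftView₁ (F : Formula) : LNS → Component → LNS → LNS → Set where
  before : ∀ {G G' c H} → Shift F G G' → ShiftView₁ F G c H (G' ++ c ∷ H)
  after  : ∀ {G c H H'} → Shift F H H' → ShiftView₁ F G c H (G ++ c ∷ H')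
  out-of : ∀ {G Γ Δ Δ₁ Γ₂ Δ₂ Δ₂' H} → Δ ↭ F ∷ Δ₁ → Δ₂' ↭ F ∷ Δ₂ →
           ShiftView₁ F G (Γ ⊢ Δ) ((Γ₂ ⊢ Δ₂) ∷ H) (G ++ (Γ ⊢ Δ₁) ∷ (Γ₂ ⊢ Δ₂') ∷ H)
  into   : ∀ {G Γ Δ Δ₁ Γ₂ Δ₂ Δ₂' H} → Δ ↭ F ∷ Δ₁ → Δ₂' ↭ F ∷ Δ₂ →
           ShiftView₁ F (G ++ [ Γ ⊢ Δ ]) (Γ₂ ⊢ Δ₂) H ((G ++ [ Γ ⊢ Δ₁ ]) ++ (Γ₂ ⊢ Δ₂') ∷ H)

shiftView₁ : ∀ {F} G c H {T} → Shift F (G ++ c ∷ H) T → ShiftView₁ F G c H T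
shiftView₁ []          c H (shift p q) = out-of p q
shiftView₁ []          c H (pass s)    = after s
shiftView₁ (g ∷ [])    c H (shift p q) = into {G = []} p q
shiftView₁ (g ∷ _ ∷ G) c H (shift p q) = before (shift p q)
shiftView₁ (g ∷ G)     c H (pass s) with shiftView₁ G c H s
... | before s'         = before (pass s')
... | after s'          = after s'
... | out-of p q        = out-of p q
... | into {G = G₀} p q = into {G = g ∷ G₀} p q

data ShiftView₂ (F : Formula) : LNS → Component → Component → LNS → LNS → Set where
  before  : ∀ {G G' c₁ c₂ H} → Shift F G G' → ShiftView₂ F G c₁ c₂ H (G' ++ c₁ ∷ c₂ ∷ H)
  after   : ∀ {G c₁ c₂ H H'} → Shift F H H' → ShiftView₂ F G c₁ c₂ H (G ++ c₁ ∷ c₂ ∷ H')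
  into    : ∀ {G Γ Δ Δ₁ Γ₂ Δ₂ Δ₂' c₂ H} → Δ ↭ F ∷ Δ₁ → Δ₂' ↭ F ∷ Δ₂ →
            ShiftView₂ F (G ++ [ Γ ⊢ Δ ]) (Γ₂ ⊢ Δ₂) c₂ H ((G ++ [ Γ ⊢ Δ₁ ]) ++ (Γ₂ ⊢ Δ₂') ∷ c₂ ∷ H)
  across  : ∀ {G Γ Δ Δ₁ Γ₂ Δ₂ Δ₂' H} → Δ ↭ F ∷ Δ₁ → Δ₂' ↭ F ∷ Δ₂ →
            ShiftView₂ F G (Γ ⊢ Δ) (Γ₂ ⊢ Δ₂) H (G ++ (Γ ⊢ Δ₁) ∷ (Γ₂ ⊢ Δ₂') ∷ H)
  out-of  : ∀ {G c₁ Γ Δ Δ₁ Γ₂ Δ₂ Δ₂' H} → Δ ↭ F ∷ Δ₁ → Δ₂' ↭ F ∷ Δ₂ →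
            ShiftView₂ F G c₁ (Γ ⊢ Δ) ((Γ₂ ⊢ Δ₂) ∷ H) (G ++ c₁ ∷ (Γ ⊢ Δ₁) ∷ (Γ₂ ⊢ Δ₂') ∷ H)

shiftView₂ : ∀ {F} G c₁ c₂ H {T} → Shift F (G ++ c₁ ∷ c₂ ∷ H) T → ShiftView₂ F G c₁ c₂ H T
shiftView₂ []          c₁ c₂ H (shift p q)        = across p q
shiftView₂ []          c₁ c₂ H (pass (shift p q)) = out-of p q
shiftView₂ []          c₁ c₂ H (pass (pass s))    = after s
shiftView₂ (g ∷ [])    c₁ c₂ H (shift p q)        = into {G = []} p q
shiftView₂ (g ∷ _ ∷ G) c₁ c₂ H (shift p q)        = before (shift p q)
shiftView₂ (g ∷ G)     c₁ c₂ H (pass s) with shiftView₂ G c₁ c₂ H s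
... | before s'         = before (pass s')
... | after s'          = after s'
... | into {G = G₀} p q = into {G = g ∷ G₀} p q
... | across p q        = across p q
... | out-of p q        = out-of p q

Initial-shift : ∀ {F S T} → Initial S → Shift F S T → Initial T
Initial-shift (atom-here pΓ pΔ) (shift p q) with ↭.∈-resp-↭ p pΔ
... | here refl = atom-later pΓ (here (↭∷⇒∈ q))
... | there pΔ₁ = atom-here pΓ pΔ₁
Initial-shift (atom-here pΓ pΔ)          (pass s)    = atom-here pΓ pΔ
Initial-shift (atom-later pΓ (here pΔ))  (shift p q) = atom-later pΓ (here (↭∷-∈ pΔ q))
Initial-shift (atom-later pΓ (there pL)) (shift p q) = atom-later pΓ (there pL)
Initial-shift (atom-later pΓ pL)         (pass s)    = atom-later pΓ (later pL s)
  where
  later : ∀ {F A L L'} → Any (λ c → A ∈ succ c) L → Shift F L L' → Any (λ c → A ∈ succ c) L'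
  later (here pΔ) (shift p q) with ↭.∈-resp-↭ p pΔ
  ... | here refl = there (here (↭∷⇒∈ q))
  ... | there pΔ₁ = here pΔ₁
  later (there (here pΔ))  (shift p q) = there (here (↭∷-∈ pΔ q))
  later (there (there pL)) (shift p q) = there (there pL)
  later (here pΔ)          (pass s)    = here pΔ
  later (there pL)         (pass s)    = there (later pL s)
Initial-shift (⊥-here pΓ) (shift p q) = ⊥-here pΓ
Initial-shift (⊥-here pΓ) (pass s)    = ⊥-here pΓ
Initial-shift (skip i)    (shift p q) = skip (widen i q)
  where
  widen : ∀ {F Γ₂ Δ₂ Δ₂' H} → Initial ((Γ₂ ⊢ Δ₂) ∷ H) → Δ₂' ↭ F ∷ Δ₂ → Initial ((Γ₂ ⊢ Δ₂') ∷ H)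
  widen (atom-here pΓ pΔ)  q = atom-here pΓ (↭∷-∈ pΔ q)
  widen (atom-later pΓ pL) q = atom-later pΓ pL
  widen (⊥-here pΓ)        q = ⊥-here pΓ
  widen (skip i)           q = skip i
Initial-shift (skip i)    (pass s)    = skip (Initial-shift i s)

ShiftIH : ℕ → Set
ShiftIH m = ∀ {F S T} → Der m S → Shift F S T → Der m T

module _ {m} (ih : ShiftIH m) {F : Formula} where

  local₁-out-of : ∀ {G Γ Δ Δ₁ Γ₂ Δ₂ Δ₂' H c₁} → LocalRule₁ (Γ ⊢ Δ) c₁ → Δ ↭ F ∷ Δ₁ → Δ₂' ↭ F ∷ Δ₂ →
                  Der m (G ++ c₁ ∷ (Γ₂ ⊢ Δ₂) ∷ H) → Der (suc m) (G ++ (Γ ⊢ Δ₁) ∷ (Γ₂ ⊢ Δ₂') ∷ H)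
  local₁-out-of {G} (l∧ q)   p₁ p₂ d = local₁ G _ (l∧ q) (ih d (shift-at G _ p₁ p₂))
  local₁-out-of {G} (l∀ a q) p₁ p₂ d = local₁ G _ (l∀ a q) (ih d (shift-at G _ p₁ p₂))
  local₁-out-of {G} {Γ} {Δ₁ = Δ₁} {H = H} (r∨ {A = P} {Q} q) p₁ p₂ d with remove₂ q p₁
  ... | same refl Δ₀↭Δ₁ =
    Der-assocˡ G _ _ (local₁ (G ++ [ Γ ⊢ Δ₁ ]) H (r∨ p₂) (Der-assocʳ G _ _
      (ih (ih d (shift-at G H (↭-swap P Q ↭-refl) ↭-refl)) (shift-at G H (↭-prep P Δ₀↭Δ₁) ↭-refl))))
  ... | distinct _ Δ₀↭ Δ₁↭ = local₁ G _ (r∨ Δ₁↭) (ih d (shift-at G _ (↭-prep₂-under Δ₀↭) p₂))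
  local₁-out-of {G} {Γ} {Δ₁ = Δ₁} {H = H} (r∃ a q) p₁ p₂ d with remove₂ q p₁
  ... | same refl _ =
    Der-assocˡ G _ _ (local₁ (G ++ [ Γ ⊢ Δ₁ ]) H (r∃ a p₂) (Der-assocʳ G _ _
      (ih (ih d (shift-at G H ↭-refl ↭-refl)) (shift-at G H p₁ (↭-prep-under p₂)))))
  ... | distinct _ _ Δ₁↭ = local₁ G _ (r∃ a Δ₁↭) (ih d (shift-at G _ (↭-prep-under p₁) p₂))

  local₁-into : ∀ {G Γ Δ Δ₁ Γ₂ Δ₂ Δ₂' H c₁} → LocalRule₁ (Γ₂ ⊢ Δ₂) c₁ → Δ ↭ F ∷ Δ₁ → Δ₂' ↭ F ∷ Δ₂ →
                Der m ((G ++ [ Γ ⊢ Δ ]) ++ c₁ ∷ H) → Der (suc m) ((G ++ [ Γ ⊢ Δ₁ ]) ++ (Γ₂ ⊢ Δ₂') ∷ H)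
  local₁-into {G} {Γ} {Δ₁ = Δ₁} {H = H} (l∧ q) p₁ p₂ d =
    local₁ (G ++ [ Γ ⊢ Δ₁ ]) H (l∧ q) (ih d (shift-at-last G H p₁ p₂))
  local₁-into {G} {Γ} {Δ₁ = Δ₁} {H = H} (l∀ a q) p₁ p₂ d =
    local₁ (G ++ [ Γ ⊢ Δ₁ ]) H (l∀ a q) (ih d (shift-at-last G H p₁ p₂))
  local₁-into {G} {Γ} {Δ₁ = Δ₁} {H = H} (r∨ {Δ = Δ₀} {A = P} {Q} q) p₁ p₂ d =
    local₁ (G ++ [ Γ ⊢ Δ₁ ]) H (r∨ (↭-select₂ p₂ q)) (ih d (shift-at-last G H p₁ (↭.shift F (P ∷ Q ∷ []) Δ₀)))
  local₁-into {G} {Γ} {Δ₁ = Δ₁} {H = H} (r∃ a q) p₁ p₂ d =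
    local₁ (G ++ [ Γ ⊢ Δ₁ ]) H (r∃ a (↭-select₂ p₂ q)) (ih d (shift-at-last G H p₁ (↭-prep-under p₂)))

  local₂-out-of : ∀ {G Γ Δ Δ₁ Γ₂ Δ₂ Δ₂' H c₁ c₂} → LocalRule₂ (Γ ⊢ Δ) c₁ c₂ → Δ ↭ F ∷ Δ₁ → Δ₂' ↭ F ∷ Δ₂ →
                  Der m (G ++ c₁ ∷ (Γ₂ ⊢ Δ₂) ∷ H) → Der m (G ++ c₂ ∷ (Γ₂ ⊢ Δ₂) ∷ H) →
                  Der (suc m) (G ++ (Γ ⊢ Δ₁) ∷ (Γ₂ ⊢ Δ₂') ∷ H)
  local₂-out-of {G} (l∨ q) p₁ p₂ d e =
    local₂ G _ (l∨ q) (ih d (shift-at G _ p₁ p₂)) (ih e (shift-at G _ p₁ p₂))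
  local₂-out-of {G} (l⊃ q) p₁ p₂ d e =
    local₂ G _ (l⊃ q) (ih d (shift-at G _ p₁ p₂)) (ih e (shift-at G _ (↭-prep-under p₁) p₂))
  local₂-out-of {G} {Γ} {Δ₁ = Δ₁} {H = H} (r∧ {A = P} {Q} q) p₁ p₂ d e with remove₂ q p₁
  ... | same refl Δ₀↭Δ₁ =
    Der-assocˡ G _ _ (local₂ (G ++ [ Γ ⊢ Δ₁ ]) H (r∧ p₂)
      (Der-assocʳ G _ _ (ih d (shift-at G H (↭-prep P Δ₀↭Δ₁) ↭-refl)))
      (Der-assocʳ G _ _ (ih e (shift-at G H (↭-prep Q Δ₀↭Δ₁) ↭-refl))))
  ... | distinct _ Δ₀↭ Δ₁↭ =
    local₂ G _ (r∧ Δ₁↭) (ih d (shift-at G _ (↭-prep-under Δ₀↭) p₂)) (ih e (shift-at G _ (↭-prep-under Δ₀↭) p₂))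

  local₂-into : ∀ {G Γ Δ Δ₁ Γ₂ Δ₂ Δ₂' H c₁ c₂} → LocalRule₂ (Γ₂ ⊢ Δ₂) c₁ c₂ → Δ ↭ F ∷ Δ₁ → Δ₂' ↭ F ∷ Δ₂ →
                Der m ((G ++ [ Γ ⊢ Δ ]) ++ c₁ ∷ H) → Der m ((G ++ [ Γ ⊢ Δ ]) ++ c₂ ∷ H) →
                Der (suc m) ((G ++ [ Γ ⊢ Δ₁ ]) ++ (Γ₂ ⊢ Δ₂') ∷ H)
  local₂-into {G} {Γ} {Δ₁ = Δ₁} {H = H} (l∨ q) p₁ p₂ d e =
    local₂ (G ++ [ Γ ⊢ Δ₁ ]) H (l∨ q) (ih d (shift-at-last G H p₁ p₂)) (ih e (shift-at-last G H p₁ p₂))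
  local₂-into {G} {Γ} {Δ₁ = Δ₁} {H = H} (l⊃ q) p₁ p₂ d e =
    local₂ (G ++ [ Γ ⊢ Δ₁ ]) H (l⊃ q) (ih d (shift-at-last G H p₁ p₂)) (ih e (shift-at-last G H p₁ (↭-prep-under p₂)))
  local₂-into {G} {Γ} {Δ₁ = Δ₁} {H = H} (r∧ q) p₁ p₂ d e =
    local₂ (G ++ [ Γ ⊢ Δ₁ ]) H (r∧ (↭-select₂ p₂ q))
      (ih d (shift-at-last G H p₁ (↭-prep-under ↭-refl))) (ih e (shift-at-last G H p₁ (↭-prep-under ↭-refl)))

  shift-∃l : ∀ G H Γ Δ Γ' x A a → Γ' ↭ ∃' x A ∷ Γ → ¬ OccS a (G ++ (Γ' ⊢ Δ) ∷ H) →
             Der m (G ++ ((A [ a / x ]) ∷ Γ ⊢ Δ) ∷ H) →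
             ∀ {T} → Shift F (G ++ (Γ' ⊢ Δ) ∷ H) T → Der (suc m) T
  shift-∃l G H Γ Δ Γ' x A a p a∉ d s with shiftView₁ G (Γ' ⊢ Δ) H s
  ... | before {G' = G'} s' =
    ∃l-fresh G' H Γ Δ Γ' x A p λ b → ih (∃l-rename G b H Γ Δ Γ' x A p a∉ d) (Shift-++⁺ˡ _ s')
  ... | after {H' = H'} s' =
    ∃l-fresh G H' Γ Δ Γ' x A p λ b → ih (∃l-rename G b H Γ Δ Γ' x A p a∉ d) (Shift-++⁺ʳ G (pass s'))
  ... | out-of {Δ₁ = Δ₁} {Γ₂ = Γ₂} {Δ₂' = Δ₂'} {H = H₀} p₁ p₂ =
    ∃l-fresh G ((Γ₂ ⊢ Δ₂') ∷ H₀) Γ Δ₁ Γ' x A p λ b →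
      ih (∃l-rename G b H Γ Δ Γ' x A p a∉ d) (shift-at G H₀ p₁ p₂)
  ... | into {G = G₀} {Γ = Γ₀} {Δ₁ = Δ₁} {Δ₂' = Δ₂'} p₁ p₂ =
    ∃l-fresh (G₀ ++ [ Γ₀ ⊢ Δ₁ ]) H Γ Δ₂' Γ' x A p λ b →
      ih (∃l-rename _ b H Γ Δ Γ' x A p a∉ d) (shift-at-last G₀ H p₁ p₂)

  shift-⊃r₁ : ∀ G Γ Δ Δ' A B → Δ' ↭ (A ⊃ B) ∷ Δ → Der m (G ++ (Γ ⊢ Δ) ∷ [ [ A ] ⊢ [ B ] ]) →
              ∀ {T} → Shift F (G ++ [ Γ ⊢ Δ' ]) T → Der (suc m) T
  shift-⊃r₁ G Γ Δ Δ' A B p d s with shiftView₁ G (Γ ⊢ Δ') [] s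
  ... | before {G' = G'} s' = ⊃r₁ G' Γ Δ Δ' A B p (ih d (Shift-++⁺ˡ _ s'))
  ... | into {G = G₀} {Γ = Γ₀} {Δ₁ = Δ₁} {Δ₂' = Δ₂'} p₁ p₂ =
    ⊃r₁ (G₀ ++ [ Γ₀ ⊢ Δ₁ ]) Γ (F ∷ Δ) Δ₂' A B (↭-select₂ p₂ p) (ih d (shift-at-last G₀ _ p₁ ↭-refl))

  shift-∀r₁ : ∀ G Γ Δ Δ' x A a → Δ' ↭ ∀' x A ∷ Δ → ¬ OccS a (G ++ [ Γ ⊢ Δ' ]) →
              Der m (G ++ (Γ ⊢ Δ) ∷ [ [] ⊢ [ A [ a / x ] ] ]) →
              ∀ {T} → Shift F (G ++ [ Γ ⊢ Δ' ]) T → Der (suc m) T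
  shift-∀r₁ G Γ Δ Δ' x A a p a∉ d s with shiftView₁ G (Γ ⊢ Δ') [] s
  ... | before {G' = G'} s' =
    ∀r₁-fresh G' Γ Δ Δ' x A p λ b → ih (∀r₁-rename G b Γ Δ Δ' x A p a∉ d) (Shift-++⁺ˡ _ s')
  ... | into {G = G₀} {Γ = Γ₀} {Δ₁ = Δ₁} {Δ₂' = Δ₂'} p₁ p₂ =
    ∀r₁-fresh (G₀ ++ [ Γ₀ ⊢ Δ₁ ]) Γ (F ∷ Δ) Δ₂' x A (↭-select₂ p₂ p)
      λ b → ih (∀r₁-rename _ b Γ Δ Δ' x A p a∉ d) (shift-at-last G₀ _ p₁ ↭-refl)

  shift-lift : ∀ G H Γ₁ Δ₁ Γ₂ Δ₂ A → A ∈ Γ₁ → Der m (G ++ (Γ₁ ⊢ Δ₁) ∷ (A ∷ Γ₂ ⊢ Δ₂) ∷ H) →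
               ∀ {T} → Shift F (G ++ (Γ₁ ⊢ Δ₁) ∷ (Γ₂ ⊢ Δ₂) ∷ H) T → Der (suc m) T
  shift-lift G H Γ₁ Δ₁ Γ₂ Δ₂ A A∈ d s with shiftView₂ G (Γ₁ ⊢ Δ₁) (Γ₂ ⊢ Δ₂) H s
  ... | before {G' = G'} s' = lift G' H Γ₁ Δ₁ Γ₂ Δ₂ A A∈ (ih d (Shift-++⁺ˡ _ s'))
  ... | after {H' = H'} s'  = lift G H' Γ₁ Δ₁ Γ₂ Δ₂ A A∈ (ih d (Shift-++⁺ʳ G (pass (pass s'))))
  ... | into {G = G₀} {Γ = Γ₀} {Δ₁ = Δ₀} {Δ₂' = Δ₁'} p₁ p₂ =
    lift (G₀ ++ [ Γ₀ ⊢ Δ₀ ]) H Γ₁ Δ₁' Γ₂ Δ₂ A A∈ (ih d (shift-at-last G₀ _ p₁ p₂))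
  ... | across {Δ₁ = Δ₁*} {Δ₂' = Δ₂'} p₁ p₂ = lift G H Γ₁ Δ₁* Γ₂ Δ₂' A A∈ (ih d (shift-at G _ p₁ p₂))
  ... | out-of {Δ₁ = Δ₂*} {Γ₂ = Γ₃} {Δ₂' = Δ₃'} {H = H₀} p₁ p₂ =
    lift G ((Γ₃ ⊢ Δ₃') ∷ H₀) Γ₁ Δ₁ Γ₂ Δ₂* A A∈ (ih d (Shift-++⁺ʳ G (pass (shift p₁ p₂))))

  shift-⊃r₂ : ∀ G H Γ₁ Δ₁ Γ₂ Δ₂ Δ₁' A B → Δ₁' ↭ (A ⊃ B) ∷ Δ₁ →
              Der m (G ++ (Γ₁ ⊢ Δ₁) ∷ ([ A ] ⊢ [ B ]) ∷ (Γ₂ ⊢ Δ₂) ∷ H) →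
              Der m (G ++ (Γ₁ ⊢ Δ₁) ∷ (Γ₂ ⊢ (A ⊃ B) ∷ Δ₂) ∷ H) →
              ∀ {T} → Shift F (G ++ (Γ₁ ⊢ Δ₁') ∷ (Γ₂ ⊢ Δ₂) ∷ H) T → Der (suc m) T
  shift-⊃r₂ G H Γ₁ Δ₁ Γ₂ Δ₂ Δ₁' A B p d e s with shiftView₂ G (Γ₁ ⊢ Δ₁') (Γ₂ ⊢ Δ₂) H s
  ... | before {G' = G'} s' = ⊃r₂ G' H Γ₁ Δ₁ Γ₂ Δ₂ Δ₁' A B p (ih d (Shift-++⁺ˡ _ s')) (ih e (Shift-++⁺ˡ _ s'))
  ... | after {H' = H'} s' =
    ⊃r₂ G H' Γ₁ Δ₁ Γ₂ Δ₂ Δ₁' A B p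
      (ih d (Shift-++⁺ʳ G (pass (pass (pass s'))))) (ih e (Shift-++⁺ʳ G (pass (pass s'))))
  ... | into {G = G₀} {Γ = Γ₀} {Δ₁ = Δ₀} {Δ₂' = Δ₁''} p₁ p₂ =
    ⊃r₂ (G₀ ++ [ Γ₀ ⊢ Δ₀ ]) H Γ₁ (F ∷ Δ₁) Γ₂ Δ₂ Δ₁'' A B (↭-select₂ p₂ p)
      (ih d (shift-at-last G₀ _ p₁ ↭-refl)) (ih e (shift-at-last G₀ _ p₁ ↭-refl))
  ... | out-of {Δ₁ = Δ₂*} {Γ₂ = Γ₃} {Δ₂' = Δ₃'} {H = H₀} p₁ p₂ =
    ⊃r₂ G ((Γ₃ ⊢ Δ₃') ∷ H₀) Γ₁ Δ₁ Γ₂ Δ₂* Δ₁' A B p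
      (ih d (Shift-++⁺ʳ G (pass (pass (shift p₁ p₂))))) (ih e (Shift-++⁺ʳ G (pass (shift (↭-prep-under p₁) p₂))))
  ... | across {Δ₁ = Δ₁*} {Δ₂' = Δ₂'} p₁ p₂ with remove₂ p p₁
  -- Moving the principal formula itself yields the right premise.
  ...   | same refl Δ₁↭ =
    Der-suc (weaken e (λ a → a) (Pw.++⁺ (Weakening-refl G)
      (id-⊑ (⊆ₘ-refl _) (⊆ₘ-↭ (↭-sym Δ₁↭)) ∷ id-⊑ (⊆ₘ-refl _) (⊆ₘ-↭ p₂) ∷ Weakening-refl H)))
  ...   | distinct Δ₀ Δ₁↭ Δ₁*↭ =
    ⊃r₂ G H Γ₁ Δ₀ Γ₂ Δ₂' Δ₁* A B Δ₁*↭
      (ih (ih d (shift-at G _ Δ₁↭ ↭-refl)) (Shift-++⁺ʳ G (pass (shift ↭-refl p₂))))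
      (ih e (shift-at G _ Δ₁↭ (↭-prep-under p₂)))

  shift-∀r₂ : ∀ G H Γ₁ Δ₁ Γ₂ Δ₂ Δ₁' x A a → Δ₁' ↭ ∀' x A ∷ Δ₁ →
              ¬ OccS a (G ++ (Γ₁ ⊢ Δ₁') ∷ (Γ₂ ⊢ Δ₂) ∷ H) →
              Der m (G ++ (Γ₁ ⊢ Δ₁) ∷ ([] ⊢ [ A [ a / x ] ]) ∷ (Γ₂ ⊢ Δ₂) ∷ H) →
              Der m (G ++ (Γ₁ ⊢ Δ₁) ∷ (Γ₂ ⊢ ∀' x A ∷ Δ₂) ∷ H) →
              ∀ {T} → Shift F (G ++ (Γ₁ ⊢ Δ₁') ∷ (Γ₂ ⊢ Δ₂) ∷ H) T → Der (suc m) T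
  shift-∀r₂ G H Γ₁ Δ₁ Γ₂ Δ₂ Δ₁' x A a p a∉ d e s with shiftView₂ G (Γ₁ ⊢ Δ₁') (Γ₂ ⊢ Δ₂) H s
  ... | before {G' = G'} s' =
    ∀r₂-fresh G' H Γ₁ Δ₁ Γ₂ Δ₂ Δ₁' x A p (λ b → ih (d′ b) (Shift-++⁺ˡ _ s')) (ih e (Shift-++⁺ˡ _ s'))
    where d′ = λ b → ∀r₂-rename G b H Γ₁ Δ₁ Γ₂ Δ₂ Δ₁' x A p a∉ d
  ... | after {H' = H'} s' =
    ∀r₂-fresh G H' Γ₁ Δ₁ Γ₂ Δ₂ Δ₁' x A p (λ b → ih (d′ b) (Shift-++⁺ʳ G (pass (pass (pass s')))))
      (ih e (Shift-++⁺ʳ G (pass (pass s'))))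
    where d′ = λ b → ∀r₂-rename G b H Γ₁ Δ₁ Γ₂ Δ₂ Δ₁' x A p a∉ d
  ... | into {G = G₀} {Γ = Γ₀} {Δ₁ = Δ₀} {Δ₂' = Δ₁''} p₁ p₂ =
    ∀r₂-fresh (G₀ ++ [ Γ₀ ⊢ Δ₀ ]) H Γ₁ (F ∷ Δ₁) Γ₂ Δ₂ Δ₁'' x A (↭-select₂ p₂ p)
      (λ b → ih (∀r₂-rename _ b H Γ₁ Δ₁ Γ₂ Δ₂ Δ₁' x A p a∉ d) (shift-at-last G₀ _ p₁ ↭-refl))
      (ih e (shift-at-last G₀ _ p₁ ↭-refl))
  ... | out-of {Δ₁ = Δ₂*} {Γ₂ = Γ₃} {Δ₂' = Δ₃'} {H = H₀} p₁ p₂ =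
    ∀r₂-fresh G ((Γ₃ ⊢ Δ₃') ∷ H₀) Γ₁ Δ₁ Γ₂ Δ₂* Δ₁' x A p
      (λ b → ih (∀r₂-rename G b H Γ₁ Δ₁ Γ₂ Δ₂ Δ₁' x A p a∉ d) (Shift-++⁺ʳ G (pass (pass (shift p₁ p₂)))))
      (ih e (Shift-++⁺ʳ G (pass (shift (↭-prep-under p₁) p₂))))
  ... | across {Δ₁ = Δ₁*} {Δ₂' = Δ₂'} p₁ p₂ with remove₂ p p₁
  ...   | same refl Δ₁↭ =
    Der-suc (weaken e (λ a → a) (Pw.++⁺ (Weakening-refl G)
      (id-⊑ (⊆ₘ-refl _) (⊆ₘ-↭ (↭-sym Δ₁↭)) ∷ id-⊑ (⊆ₘ-refl _) (⊆ₘ-↭ p₂) ∷ Weakening-refl H)))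
  ...   | distinct Δ₀ Δ₁↭ Δ₁*↭ =
    ∀r₂-fresh G H Γ₁ Δ₀ Γ₂ Δ₂' Δ₁* x A Δ₁*↭
      (λ b → ih (ih (∀r₂-rename G b H Γ₁ Δ₁ Γ₂ Δ₂ Δ₁' x A p a∉ d) (shift-at G _ Δ₁↭ ↭-refl))
                (Shift-++⁺ʳ G (pass (shift ↭-refl p₂))))
      (ih e (shift-at G _ Δ₁↭ (↭-prep-under p₂)))

Der-shift : ∀ n {F S T} → Der n S → Shift F S T → Der n T
Der-shift n (initial i) s = initial (Initial-shift i s)
Der-shift (suc m) (local₁ G H {c} r d) s with shiftView₁ G c H s
... | before s'     = local₁ _ H r (Der-shift m d (Shift-++⁺ˡ _ s'))
... | after s'      = local₁ G _ r (Der-shift m d (Shift-++⁺ʳ G (pass s')))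
... | out-of p₁ p₂  = local₁-out-of (Der-shift m) r p₁ p₂ d
... | into p₁ p₂    = local₁-into (Der-shift m) r p₁ p₂ d
Der-shift (suc m) (local₂ G H {c} r d e) s with shiftView₁ G c H s
... | before s'     = local₂ _ H r (Der-shift m d (Shift-++⁺ˡ _ s')) (Der-shift m e (Shift-++⁺ˡ _ s'))
... | after s'      = local₂ G _ r (Der-shift m d (Shift-++⁺ʳ G (pass s'))) (Der-shift m e (Shift-++⁺ʳ G (pass s')))
... | out-of p₁ p₂  = local₂-out-of (Der-shift m) r p₁ p₂ d e
... | into p₁ p₂    = local₂-into (Der-shift m) r p₁ p₂ d e
Der-shift (suc m) (∃l G H Γ Δ Γ' x A a p a∉ d) s = shift-∃l (Der-shift m) G H Γ Δ Γ' x A a p a∉ d s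
Der-shift (suc m) (⊃r₁ G Γ Δ Δ' A B p d) s = shift-⊃r₁ (Der-shift m) G Γ Δ Δ' A B p d s
Der-shift (suc m) (∀r₁ G Γ Δ Δ' x A a p a∉ d) s = shift-∀r₁ (Der-shift m) G Γ Δ Δ' x A a p a∉ d s
Der-shift (suc m) (lift G H Γ₁ Δ₁ Γ₂ Δ₂ A A∈ d) s = shift-lift (Der-shift m) G H Γ₁ Δ₁ Γ₂ Δ₂ A A∈ d s
Der-shift (suc m) (⊃r₂ G H Γ₁ Δ₁ Γ₂ Δ₂ Δ₁' A B p d e) s =
  shift-⊃r₂ (Der-shift m) G H Γ₁ Δ₁ Γ₂ Δ₂ Δ₁' A B p d e s
Der-shift (suc m) (∀r₂ G H Γ₁ Δ₁ Γ₂ Δ₂ Δ₁' x A a p a∉ d e) s =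
  shift-∀r₂ (Der-shift m) G H Γ₁ Δ₁ Γ₂ Δ₂ Δ₁' x A a p a∉ d e s

-- Unfolding a succedent implication into a new component

⊃-comp : Multiset → Formula → Formula → Component
⊃-comp Π A B = (Π ++ [ A ]) ⊢ [ B ]

data Unfold (A B : Formula) (Π : Multiset) : LNS → LNS → Set where
  unfold : ∀ {Γ Δ Δ₁ H} → Δ ↭ (A ⊃ B) ∷ Δ₁ → Unfold A B Π ((Γ ⊢ Δ) ∷ H) ((Γ ⊢ Δ₁) ∷ ⊃-comp Π A B ∷ H)
  pass   : ∀ {c L L'} → Unfold A B Π L L' → Unfold A B Π (c ∷ L) (c ∷ L')

module _ {A B : Formula} {Π : Multiset} where

  Unfold-++⁺ˡ : ∀ {G G'} X → Unfold A B Π G G' → Unfold A B Π (G ++ X) (G' ++ X)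
  Unfold-++⁺ˡ X (unfold p) = unfold p
  Unfold-++⁺ˡ X (pass u)   = pass (Unfold-++⁺ˡ X u)

  Unfold-++⁺ʳ : ∀ {H H'} G → Unfold A B Π H H' → Unfold A B Π (G ++ H) (G ++ H')
  Unfold-++⁺ʳ []      u = u
  Unfold-++⁺ʳ (c ∷ G) u = pass (Unfold-++⁺ʳ G u)

  unfold-at : ∀ {Γ Δ Δ₁} G H → Δ ↭ (A ⊃ B) ∷ Δ₁ →
              Unfold A B Π (G ++ (Γ ⊢ Δ) ∷ H) (G ++ (Γ ⊢ Δ₁) ∷ ⊃-comp Π A B ∷ H)
  unfold-at G H p = Unfold-++⁺ʳ G (unfold p)

  data UnfoldView₁ : LNS → Component → LNS → LNS → Set where
    before : ∀ {G G' c H} → Unfold A B Π G G' → UnfoldView₁ G c H (G' ++ c ∷ H)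
    after  : ∀ {G c H H'} → Unfold A B Π H H' → UnfoldView₁ G c H (G ++ c ∷ H')
    at     : ∀ {G Γ Δ Δ₁ H} → Δ ↭ (A ⊃ B) ∷ Δ₁ → UnfoldView₁ G (Γ ⊢ Δ) H (G ++ (Γ ⊢ Δ₁) ∷ ⊃-comp Π A B ∷ H)

  unfoldView₁ : ∀ G c H {T} → Unfold A B Π (G ++ c ∷ H) T → UnfoldView₁ G c H T
  unfoldView₁ []      c H (unfold p) = at p
  unfoldView₁ []      c H (pass u)   = after u
  unfoldView₁ (g ∷ G) c H (unfold p) = before (unfold p)
  unfoldView₁ (g ∷ G) c H (pass u) with unfoldView₁ G c H u
  ... | before u' = before (pass u')
  ... | after u'  = after u'
  ... | at p      = at p

  data UnfoldView₂ : LNS → Component → Component → LNS → LNS → Set where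
    before : ∀ {G G' c₁ c₂ H} → Unfold A B Π G G' → UnfoldView₂ G c₁ c₂ H (G' ++ c₁ ∷ c₂ ∷ H)
    after  : ∀ {G c₁ c₂ H H'} → Unfold A B Π H H' → UnfoldView₂ G c₁ c₂ H (G ++ c₁ ∷ c₂ ∷ H')
    at₁    : ∀ {G Γ Δ Δ₁ c₂ H} → Δ ↭ (A ⊃ B) ∷ Δ₁ →
             UnfoldView₂ G (Γ ⊢ Δ) c₂ H (G ++ (Γ ⊢ Δ₁) ∷ ⊃-comp Π A B ∷ c₂ ∷ H)
    at₂    : ∀ {G c₁ Γ Δ Δ₁ H} → Δ ↭ (A ⊃ B) ∷ Δ₁ →
             UnfoldView₂ G c₁ (Γ ⊢ Δ) H (G ++ c₁ ∷ (Γ ⊢ Δ₁) ∷ ⊃-comp Π A B ∷ H)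

  unfoldView₂ : ∀ G c₁ c₂ H {T} → Unfold A B Π (G ++ c₁ ∷ c₂ ∷ H) T → UnfoldView₂ G c₁ c₂ H T
  unfoldView₂ []      c₁ c₂ H (unfold p)        = at₁ p
  unfoldView₂ []      c₁ c₂ H (pass (unfold p)) = at₂ p
  unfoldView₂ []      c₁ c₂ H (pass (pass u))   = after u
  unfoldView₂ (g ∷ G) c₁ c₂ H (unfold p)        = before (unfold p)
  unfoldView₂ (g ∷ G) c₁ c₂ H (pass u) with unfoldView₂ G c₁ c₂ H u
  ... | before u' = before (pass u')
  ... | after u'  = after u'
  ... | at₁ p     = at₁ p
  ... | at₂ p     = at₂ p

  Initial-unfold : ∀ {S T} → Initial S → Unfold A B Π S T → Initial T
  Initial-unfold (atom-here pΓ pΔ) (unfold p) with ↭.∈-resp-↭ p pΔ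
  ... | there pΔ₁ = atom-here pΓ pΔ₁
  Initial-unfold (atom-here pΓ pΔ)  (pass u)   = atom-here pΓ pΔ
  Initial-unfold (atom-later pΓ pL) (unfold p) = atom-later pΓ (there pL)
  Initial-unfold (atom-later pΓ pL) (pass u)   = atom-later pΓ (later pL u)
    where
    later : ∀ {p ts L L'} → Any (λ c → atom p ts ∈ succ c) L → Unfold A B Π L L' →
            Any (λ c → atom p ts ∈ succ c) L'
    later (here pΔ) (unfold p) with ↭.∈-resp-↭ p pΔ
    ... | there pΔ₁ = here pΔ₁
    later (there pL) (unfold p) = there (there pL)
    later (here pΔ)  (pass u)   = here pΔ
    later (there pL) (pass u)   = there (later pL u)
  Initial-unfold (⊥-here pΓ) (unfold p) = ⊥-here pΓ
  Initial-unfold (⊥-here pΓ) (pass u)   = ⊥-here pΓ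
  Initial-unfold (skip i)    (unfold p) = skip (skip i)
  Initial-unfold (skip i)    (pass u)   = skip (Initial-unfold i u)

module _ {A B : Formula} where

  -- No local rule has an implication as principal succedent formula.
  LocalRule₁-unfold : ∀ {Γ Δ Δ₁ c₁} → LocalRule₁ (Γ ⊢ Δ) c₁ → Δ ↭ (A ⊃ B) ∷ Δ₁ →
                      ∃ λ Δ₁' → LocalRule₁ (Γ ⊢ Δ₁) (ant c₁ ⊢ Δ₁') × succ c₁ ↭ (A ⊃ B) ∷ Δ₁'
  LocalRule₁-unfold (l∧ q)   p = _ , l∧ q , p
  LocalRule₁-unfold (l∀ a q) p = _ , l∀ a q , p
  LocalRule₁-unfold (r∨ q)   p with remove₂ p q
  ... | distinct _ Δ₁↭ Δ₀↭ = _ , r∨ Δ₁↭ , ↭-prep₂-under Δ₀↭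
  LocalRule₁-unfold (r∃ a q) p with remove₂ p q
  ... | distinct _ Δ₁↭ Δ₀↭ = _ , r∃ a Δ₁↭ , ↭-prep-under p

  LocalRule₂-unfold : ∀ {Γ Δ Δ₁ c₁ c₂} → LocalRule₂ (Γ ⊢ Δ) c₁ c₂ → Δ ↭ (A ⊃ B) ∷ Δ₁ →
                      ∃₂ λ Δ₁' Δ₂' → LocalRule₂ (Γ ⊢ Δ₁) (ant c₁ ⊢ Δ₁') (ant c₂ ⊢ Δ₂')
                                     × succ c₁ ↭ (A ⊃ B) ∷ Δ₁' × succ c₂ ↭ (A ⊃ B) ∷ Δ₂'
  LocalRule₂-unfold (l∨ q) p = _ , _ , l∨ q , p , p
  LocalRule₂-unfold (l⊃ q) p = _ , _ , l⊃ q , p , ↭-prep-under p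
  LocalRule₂-unfold (r∧ q) p with remove₂ p q
  ... | distinct _ Δ₁↭ Δ₀↭ = _ , _ , r∧ Δ₁↭ , ↭-prep-under Δ₀↭ , ↭-prep-under Δ₀↭

⊑-⊃-comp : ∀ Π A B → renComp (λ a → a) ([ A ] ⊢ [ B ]) ⊑ ⊃-comp Π A B
⊑-⊃-comp Π A B = id-⊑ (Π , ↭.++-comm Π [ A ]) (⊆ₘ-refl [ B ])

UnfoldIH : ℕ → Set
UnfoldIH m = ∀ {A B Π S T} → Der m S → Unfold A B Π S T → Derivable T

module _ {m} (ih : UnfoldIH m) {A B : Formula} {Π : Multiset} where

  unfold-local₁ : ∀ G H {c c₁} → LocalRule₁ c c₁ → Der m (G ++ c₁ ∷ H) →
                  ∀ {T} → Unfold A B Π (G ++ c ∷ H) T → Derivable T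
  unfold-local₁ G H {c} r d u with unfoldView₁ G c H u
  ... | before {G' = G'} u' = by₁ (ih d (Unfold-++⁺ˡ _ u')) (local₁ G' H r)
  ... | after {H' = H'} u'  = by₁ (ih d (Unfold-++⁺ʳ G (pass u'))) (local₁ G H' r)
  ... | at p with LocalRule₁-unfold r p
  ...   | _ , r' , p' = by₁ (ih d (unfold-at G H p')) (local₁ G (⊃-comp Π A B ∷ H) r')

  unfold-local₂ : ∀ G H {c c₁ c₂} → LocalRule₂ c c₁ c₂ → Der m (G ++ c₁ ∷ H) → Der m (G ++ c₂ ∷ H) →
                  ∀ {T} → Unfold A B Π (G ++ c ∷ H) T → Derivable T
  unfold-local₂ G H {c} r d e u with unfoldView₁ G c H u
  ... | before {G' = G'} u' = by₂ (ih d (Unfold-++⁺ˡ _ u')) (ih e (Unfold-++⁺ˡ _ u')) (local₂ G' H r)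
  ... | after {H' = H'} u'  =
    by₂ (ih d (Unfold-++⁺ʳ G (pass u'))) (ih e (Unfold-++⁺ʳ G (pass u'))) (local₂ G H' r)
  ... | at p with LocalRule₂-unfold r p
  ...   | _ , _ , r' , p₁ , p₂ =
    by₂ (ih d (unfold-at G H p₁)) (ih e (unfold-at G H p₂)) (local₂ G (⊃-comp Π A B ∷ H) r')

  unfold-∃l : ∀ G H Γ Δ Γ' x C a → Γ' ↭ ∃' x C ∷ Γ → ¬ OccS a (G ++ (Γ' ⊢ Δ) ∷ H) →
              Der m (G ++ ((C [ a / x ]) ∷ Γ ⊢ Δ) ∷ H) →
              ∀ {T} → Unfold A B Π (G ++ (Γ' ⊢ Δ) ∷ H) T → Derivable T
  unfold-∃l G H Γ Δ Γ' x C a q a∉ d u with unfoldView₁ G (Γ' ⊢ Δ) H u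
  ... | before {G' = G'} u' =
    ∃l-freshᴰ G' H Γ Δ Γ' x C q λ b → ih (∃l-rename G b H Γ Δ Γ' x C q a∉ d) (Unfold-++⁺ˡ _ u')
  ... | after {H' = H'} u' =
    ∃l-freshᴰ G H' Γ Δ Γ' x C q λ b → ih (∃l-rename G b H Γ Δ Γ' x C q a∉ d) (Unfold-++⁺ʳ G (pass u'))
  ... | at {Δ₁ = Δ₁} p =
    ∃l-freshᴰ G (⊃-comp Π A B ∷ H) Γ Δ₁ Γ' x C q λ b → ih (∃l-rename G b H Γ Δ Γ' x C q a∉ d) (unfold-at G H p)

  -- An (⊃r₁) whose principal formula is not the unfolded one becomes an
  -- instance of (⊃r₂) in front of the new last component; similarly for
  -- (∀r₁), (⊃r₂) and (∀r₂) below.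
  unfold-⊃r₁ : ∀ G Γ Δ Δ' D E → Δ' ↭ (D ⊃ E) ∷ Δ → Der m (G ++ (Γ ⊢ Δ) ∷ [ [ D ] ⊢ [ E ] ]) →
               ∀ {T} → Unfold A B Π (G ++ [ Γ ⊢ Δ' ]) T → Derivable T
  unfold-⊃r₁ G Γ Δ Δ' D E q d u with unfoldView₁ G (Γ ⊢ Δ') [] u
  ... | before {G' = G'} u' = by₁ (ih d (Unfold-++⁺ˡ _ u')) (⊃r₁ G' Γ Δ Δ' D E q)
  ... | after ()
  ... | at {Δ₁ = Δ₁} p with remove₂ q p
  ...   | same refl Δ↭ =
    m , weaken d (λ a → a)
          (Pw.++⁺ (Weakening-refl G) (id-⊑ (⊆ₘ-refl Γ) (⊆ₘ-↭ (↭-sym Δ↭)) ∷ ⊑-⊃-comp Π A B ∷ []))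
  ...   | distinct Δ₀ Δ↭ Δ₁↭ =
    by₂ (ih (Der-shift m d (shift-at G [] Δ↭ ↭-refl)) (Unfold-++⁺ʳ G (pass (unfold ↭-refl))))
        (Derivable-assocˡ G _ _ (by₁ (Derivable-assocʳ G _ _ (ih d (unfold-at G _ Δ↭)))
           (⊃r₁ (G ++ [ Γ ⊢ Δ₀ ]) (Π ++ [ A ]) [ B ] (D ⊃ E ∷ [ B ]) D E ↭-refl)))
        (⊃r₂ G [] Γ Δ₀ (Π ++ [ A ]) [ B ] Δ₁ D E Δ₁↭)

  unfold-∀r₁ : ∀ G Γ Δ Δ' x C a → Δ' ↭ ∀' x C ∷ Δ → ¬ OccS a (G ++ [ Γ ⊢ Δ' ]) →
               Der m (G ++ (Γ ⊢ Δ) ∷ [ [] ⊢ [ C [ a / x ] ] ]) →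
               ∀ {T} → Unfold A B Π (G ++ [ Γ ⊢ Δ' ]) T → Derivable T
  unfold-∀r₁ G Γ Δ Δ' x C a q a∉ d u with unfoldView₁ G (Γ ⊢ Δ') [] u
  ... | before {G' = G'} u' =
    ∀r₁-freshᴰ G' Γ Δ Δ' x C q λ b → ih (∀r₁-rename G b Γ Δ Δ' x C q a∉ d) (Unfold-++⁺ˡ _ u')
  ... | after ()
  ... | at {Δ₁ = Δ₁} p with remove₂ q p
  ...   | same () _
  ...   | distinct Δ₀ Δ↭ Δ₁↭ =
    ∀r₂-freshᴰ G [] Γ Δ₀ (Π ++ [ A ]) [ B ] Δ₁ x C Δ₁↭
      (λ b → ih (Der-shift m (d′ b) (shift-at G [] Δ↭ ↭-refl)) (Unfold-++⁺ʳ G (pass (unfold ↭-refl))))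
      (Derivable-assocˡ G _ _ (∀r₁-freshᴰ (G ++ [ Γ ⊢ Δ₀ ]) (Π ++ [ A ]) [ B ] (∀' x C ∷ [ B ]) x C ↭-refl
         λ b → Derivable-assocʳ G _ _ (ih (d′ b) (unfold-at G _ Δ↭))))
    where d′ = λ b → ∀r₁-rename G b Γ Δ Δ' x C q a∉ d

  unfold-lift : ∀ G H Γ₁ Δ₁ Γ₂ Δ₂ C → C ∈ Γ₁ → Der m (G ++ (Γ₁ ⊢ Δ₁) ∷ (C ∷ Γ₂ ⊢ Δ₂) ∷ H) →
                ∀ {T} → Unfold A B Π (G ++ (Γ₁ ⊢ Δ₁) ∷ (Γ₂ ⊢ Δ₂) ∷ H) T → Derivable T
  unfold-lift G H Γ₁ Δ₁ Γ₂ Δ₂ C C∈ d u with unfoldView₂ G (Γ₁ ⊢ Δ₁) (Γ₂ ⊢ Δ₂) H u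
  ... | before {G' = G'} u' = by₁ (ih d (Unfold-++⁺ˡ _ u')) (lift G' H Γ₁ Δ₁ Γ₂ Δ₂ C C∈)
  ... | after {H' = H'} u'  = by₁ (ih d (Unfold-++⁺ʳ G (pass (pass u')))) (lift G H' Γ₁ Δ₁ Γ₂ Δ₂ C C∈)
  ... | at₂ {Δ₁ = Δ₂*} p =
    by₁ (ih d (Unfold-++⁺ʳ G (pass (unfold p)))) (lift G (⊃-comp Π A B ∷ H) Γ₁ Δ₁ Γ₂ Δ₂* C C∈)
  ... | at₁ {Δ₁ = Δ₁*} p =
    by₁ (Derivable-assocˡ G _ _ (by₁ (Derivable-assocʳ G _ _ (ih {Π = C ∷ Π} d (unfold-at G _ p)))
          (lift (G ++ [ Γ₁ ⊢ Δ₁* ]) H (C ∷ Π ++ [ A ]) [ B ] Γ₂ Δ₂ C (here refl))))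
        (lift G ((Γ₂ ⊢ Δ₂) ∷ H) Γ₁ Δ₁* (Π ++ [ A ]) [ B ] C C∈)

  unfold-⊃r₂ : ∀ G H Γ₁ Δ₁ Γ₂ Δ₂ Δ₁' D E → Δ₁' ↭ (D ⊃ E) ∷ Δ₁ →
               Der m (G ++ (Γ₁ ⊢ Δ₁) ∷ ([ D ] ⊢ [ E ]) ∷ (Γ₂ ⊢ Δ₂) ∷ H) →
               Der m (G ++ (Γ₁ ⊢ Δ₁) ∷ (Γ₂ ⊢ (D ⊃ E) ∷ Δ₂) ∷ H) →
               ∀ {T} → Unfold A B Π (G ++ (Γ₁ ⊢ Δ₁') ∷ (Γ₂ ⊢ Δ₂) ∷ H) T → Derivable T
  unfold-⊃r₂ G H Γ₁ Δ₁ Γ₂ Δ₂ Δ₁' D E q d e u with unfoldView₂ G (Γ₁ ⊢ Δ₁') (Γ₂ ⊢ Δ₂) H u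
  ... | before {G' = G'} u' =
    by₂ (ih d (Unfold-++⁺ˡ _ u')) (ih e (Unfold-++⁺ˡ _ u')) (⊃r₂ G' H Γ₁ Δ₁ Γ₂ Δ₂ Δ₁' D E q)
  ... | after {H' = H'} u' =
    by₂ (ih d (Unfold-++⁺ʳ G (pass (pass (pass u'))))) (ih e (Unfold-++⁺ʳ G (pass (pass u'))))
        (⊃r₂ G H' Γ₁ Δ₁ Γ₂ Δ₂ Δ₁' D E q)
  ... | at₂ {Δ₁ = Δ₂*} p =
    by₂ (ih d (Unfold-++⁺ʳ G (pass (pass (unfold p))))) (ih e (Unfold-++⁺ʳ G (pass (unfold (↭-prep-under p)))))
        (⊃r₂ G (⊃-comp Π A B ∷ H) Γ₁ Δ₁ Γ₂ Δ₂* Δ₁' D E q)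
  ... | at₁ {Δ₁ = Δ₁*} p with remove₂ q p
  ...   | same refl Δ↭ =
    m , weaken d (λ a → a) (Pw.++⁺ (Weakening-refl G)
          (id-⊑ (⊆ₘ-refl Γ₁) (⊆ₘ-↭ (↭-sym Δ↭)) ∷ ⊑-⊃-comp Π A B ∷ Weakening-refl ((Γ₂ ⊢ Δ₂) ∷ H)))
  ...   | distinct Δ₀ Δ↭ Δ₁*↭ =
    by₂ (ih (Der-shift m d (shift-at G _ Δ↭ ↭-refl)) (Unfold-++⁺ʳ G (pass (unfold ↭-refl))))
        (Derivable-assocˡ G _ _ (by₂ (Derivable-assocʳ G _ _ (ih d (unfold-at G _ Δ↭)))
                                     (Derivable-assocʳ G _ _ (ih e (unfold-at G _ Δ↭)))
           (⊃r₂ (G ++ [ Γ₁ ⊢ Δ₀ ]) H (Π ++ [ A ]) [ B ] Γ₂ Δ₂ (D ⊃ E ∷ [ B ]) D E ↭-refl)))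
        (⊃r₂ G ((Γ₂ ⊢ Δ₂) ∷ H) Γ₁ Δ₀ (Π ++ [ A ]) [ B ] Δ₁* D E Δ₁*↭)

  unfold-∀r₂ : ∀ G H Γ₁ Δ₁ Γ₂ Δ₂ Δ₁' x C a → Δ₁' ↭ ∀' x C ∷ Δ₁ →
               ¬ OccS a (G ++ (Γ₁ ⊢ Δ₁') ∷ (Γ₂ ⊢ Δ₂) ∷ H) →
               Der m (G ++ (Γ₁ ⊢ Δ₁) ∷ ([] ⊢ [ C [ a / x ] ]) ∷ (Γ₂ ⊢ Δ₂) ∷ H) →
               Der m (G ++ (Γ₁ ⊢ Δ₁) ∷ (Γ₂ ⊢ ∀' x C ∷ Δ₂) ∷ H) →
               ∀ {T} → Unfold A B Π (G ++ (Γ₁ ⊢ Δ₁') ∷ (Γ₂ ⊢ Δ₂) ∷ H) T → Derivable T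
  unfold-∀r₂ G H Γ₁ Δ₁ Γ₂ Δ₂ Δ₁' x C a q a∉ d e u with unfoldView₂ G (Γ₁ ⊢ Δ₁') (Γ₂ ⊢ Δ₂) H u
  ... | before {G' = G'} u' =
    ∀r₂-freshᴰ G' H Γ₁ Δ₁ Γ₂ Δ₂ Δ₁' x C q (λ b → ih (d′ b) (Unfold-++⁺ˡ _ u')) (ih e (Unfold-++⁺ˡ _ u'))
    where d′ = λ b → ∀r₂-rename G b H Γ₁ Δ₁ Γ₂ Δ₂ Δ₁' x C q a∉ d
  ... | after {H' = H'} u' =
    ∀r₂-freshᴰ G H' Γ₁ Δ₁ Γ₂ Δ₂ Δ₁' x C q (λ b → ih (d′ b) (Unfold-++⁺ʳ G (pass (pass (pass u')))))
      (ih e (Unfold-++⁺ʳ G (pass (pass u'))))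
    where d′ = λ b → ∀r₂-rename G b H Γ₁ Δ₁ Γ₂ Δ₂ Δ₁' x C q a∉ d
  ... | at₂ {Δ₁ = Δ₂*} p =
    ∀r₂-freshᴰ G (⊃-comp Π A B ∷ H) Γ₁ Δ₁ Γ₂ Δ₂* Δ₁' x C q
      (λ b → ih (∀r₂-rename G b H Γ₁ Δ₁ Γ₂ Δ₂ Δ₁' x C q a∉ d) (Unfold-++⁺ʳ G (pass (pass (unfold p)))))
      (ih e (Unfold-++⁺ʳ G (pass (unfold (↭-prep-under p)))))
  ... | at₁ {Δ₁ = Δ₁*} p with remove₂ q p
  ...   | same () _
  ...   | distinct Δ₀ Δ↭ Δ₁*↭ =
    ∀r₂-freshᴰ G ((Γ₂ ⊢ Δ₂) ∷ H) Γ₁ Δ₀ (Π ++ [ A ]) [ B ] Δ₁* x C Δ₁*↭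
      (λ b → ih (Der-shift m (d′ b) (shift-at G _ Δ↭ ↭-refl)) (Unfold-++⁺ʳ G (pass (unfold ↭-refl))))
      (Derivable-assocˡ G _ _
        (∀r₂-freshᴰ (G ++ [ Γ₁ ⊢ Δ₀ ]) H (Π ++ [ A ]) [ B ] Γ₂ Δ₂ (∀' x C ∷ [ B ]) x C ↭-refl
         (λ b → Derivable-assocʳ G _ _ (ih (d′ b) (unfold-at G _ Δ↭)))
         (Derivable-assocʳ G _ _ (ih e (unfold-at G _ Δ↭)))))
    where d′ = λ b → ∀r₂-rename G b H Γ₁ Δ₁ Γ₂ Δ₂ Δ₁' x C q a∉ d

Der-unfold : ∀ n {A B Π S T} → Der n S → Unfold A B Π S T → Derivable T
Der-unfold n (initial i) u = 0 , initial (Initial-unfold i u)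
Der-unfold (suc m) (local₁ G H r d) u = unfold-local₁ (Der-unfold m) G H r d u
Der-unfold (suc m) (local₂ G H r d e) u = unfold-local₂ (Der-unfold m) G H r d e u
Der-unfold (suc m) (∃l G H Γ Δ Γ' x C a p a∉ d) u = unfold-∃l (Der-unfold m) G H Γ Δ Γ' x C a p a∉ d u
Der-unfold (suc m) (⊃r₁ G Γ Δ Δ' D E p d) u = unfold-⊃r₁ (Der-unfold m) G Γ Δ Δ' D E p d u
Der-unfold (suc m) (∀r₁ G Γ Δ Δ' x C a p a∉ d) u = unfold-∀r₁ (Der-unfold m) G Γ Δ Δ' x C a p a∉ d u
Der-unfold (suc m) (lift G H Γ₁ Δ₁ Γ₂ Δ₂ C C∈ d) u = unfold-lift (Der-unfold m) G H Γ₁ Δ₁ Γ₂ Δ₂ C C∈ d u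
Der-unfold (suc m) (⊃r₂ G H Γ₁ Δ₁ Γ₂ Δ₂ Δ₁' D E p d e) u =
  unfold-⊃r₂ (Der-unfold m) G H Γ₁ Δ₁ Γ₂ Δ₂ Δ₁' D E p d e u
Der-unfold (suc m) (∀r₂ G H Γ₁ Δ₁ Γ₂ Δ₂ Δ₁' x C a p a∉ d e) u =
  unfold-∀r₂ (Der-unfold m) G H Γ₁ Δ₁ Γ₂ Δ₂ Δ₁' x C a p a∉ d e u

lemma10 : ∀ (G H : LNS) (Γ₁ Δ₁ Γ₂ Δ₂ : Multiset) (A B : Formula) →
          LNIF (G ++ ((Γ₁ ⊢ (A ⊃ B) ∷ Δ₁) // (Γ₂ ⊢ Δ₂) // H)) →
          LNIF (G ++ ((Γ₁ ⊢ Δ₁) // ([ A ] ⊢ [ B ]) // (Γ₂ ⊢ Δ₂) // H))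
            × LNIF (G ++ ((Γ₁ ⊢ Δ₁) // (Γ₂ ⊢ (A ⊃ B) ∷ Δ₂) // H))
lemma10 G H Γ₁ Δ₁ Γ₂ Δ₂ A B ⊢S with LNIF⇒Derivable ⊢S
... | n , d = Der⇒LNIF (proj₂ (Der-unfold n d (unfold-at {Π = []} G _ ↭-refl)))
            , Der⇒LNIF (Der-shift n d (shift-at G H ↭-refl ↭-refl))
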